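{- Let $C_1\|C_2$ be a reachable command, $Q_1,Q_2$ assertions, $s$ a store and $h_1,h_2$ heaps with $h_1\bot h_2$ and $h=h_1\uplus h_2$, $\Gamma$ a resource context, $A_1,A_2\subseteq\mathbf{Var}$, and let $\rho=(O_1\cup O_2,L,D)$, $\rho_1=(O_1,L\cup O_2,D)$, $\rho_2=(O_2,L\cup O_1,D)$ be resource configurations. Suppose $FV(Q_i)\subseteq A_i$ for $i=1,2$ and $A_1\cap mod(C_2)=A_2\cap mod(C_1)=\emptyset$. If $\mathit{Safe}_n(C_1,s,h_1,\rho_1,\Gamma,Q_1,A_1)$ and $\mathit{Safe}_n(C_2,s,h_2,\rho_2,\Gamma,Q_2,A_2)$ hold, then $\mathit{Safe}_n(C_1\|C_2,s,h,\rho,\Gamma,Q_1\ast Q_2,A_1\cup A_2)$ holds.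
   Context: Stores $s:\mathbf{Var}\to\mathbf{Val}$; finite partial heaps; separation-logic assertions with standard satisfaction and free variables $FV$; $h\bot g$ disjoint domains, $h\uplus g$ union. Resource context $\Gamma=r_1(X_1):R_1,\dots,r_n(X_n):R_n$ (distinct names, $X_i\subseteq\mathbf{Var}$, precise $R_i$, $FV(R_i)\subseteq X_i$); $PV(r_i)=X_i$, $\Gamma(r_i)=R_i$, $\circledast_{r\in D}\Gamma(r)$ separating conjunction over $D$ ($\texttt{emp}$ if empty). Resource configuration: triple $(O,L,D)$ of pairwise disjoint sets of resource names; $r\in\rho$ iff $r\in O\cup L\cup D$; $\rho\setminus\{r\}$ componentwise removal. Commands: $\mathsf{skip}$, basic commands $x:=e$, $x:=[e]$, $[e]:=e'$, $x:=\mathsf{cons}(\dots)$, $\mathsf{dispose}(e)$ (standard semantics $[c](s,h)$, pair or $\mathsf{abort}$), $C_1;C_2$, $\mathsf{if}$, $\mathsf{while}$, $\mathsf{resource}\ r\ \mathsf{in}\ C$, $\mathsf{with}\ r\ \mathsf{when}\ B\ \mathsf{do}\ C$, $C_1\|C_2$ (unextended), and $\mathsf{within}\ r\ \mathsf{do}\ C$. $mod(C)$: variables $x$ such that $C$ contains $x:=e$, $x:=[e]$ or $x:=\mathsf{cons}(\dots)$. $Locked(C_1;C_2)=Locked(C_1)$, $Locked(C_1\|C_2)=Locked(C_1)\cup Locked(C_2)$, $Locked(\mathsf{resource}\ r\ \mathsf{in}\ C)=Locked(C)\setminus\{r\}$, $Locked(\mathsf{within}\ r\ \mathsf{do}\ C)=Locked(C)\cup\{r\}$,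 else $\emptyset$. Program transitions $\to_p$: (S1) $\mathsf{skip};C_2\to C_2$; (S2) $C_1;C_2$ steps via $C_1$; (LP) while unfolds to $\mathsf{if}\ B\ \mathsf{then}\ (C;\mathsf{while}\ B\ \mathsf{do}\ C)\ \mathsf{else}\ \mathsf{skip}$; (IF1/IF2) by $s(B)$; (P1/P2) if $C_1,\sigma\to_pC_1',\sigma'$ then $C_1\|C_2,\sigma\to_pC_1'\|C_2,\sigma'$, symmetrically for $C_2$; (P3) $\mathsf{skip}\|\mathsf{skip}\to\mathsf{skip}$; (R0) $\mathsf{resource}\ r\ \mathsf{in}\ \mathsf{skip}\to\mathsf{skip}$ if $r\notin\rho$; (R1) if $r\notin\rho=(O,L,D)$, $r\in Locked(C)$, $C,(s,h,(O\cup\{r\},L,D))\to_pC',(s',h',\rho')$ then $\mathsf{resource}\ r\ \mathsf{in}\ C,(s,h,\rho)\to_p\mathsf{resource}\ r\ \mathsf{in}\ C',(s',h',\rho'\setminus\{r\})$; (R2) same with $r\notin Locked(C)$ and $(O,L,D\cup\{r\})$; (W0) $\mathsf{with}\ r\ \mathsf{when}\ B\ \mathsf{do}\ C,(s,h,(O,L,D\cup\{r\}))\to_p\mathsf{within}\ r\ \mathsf{do}\ C,(s,h,(O\cup\{r\},L,D))$ if $s(B)=\texttt{true}$; (W1) if $r\in O$ and $C,(s,h,(O\setminus\{r\},L,D))\to_pC',(s',h',(O',L',D'))$ then $\mathsf{within}\ r\ \mathsf{do}\ C,(s,h,(O,L,D))\to_p\mathsf{within}\ r\ \mathsf{do}\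 C',(s',h',(O'\cup\{r\},L',D'))$; (W2) $\mathsf{within}\ r\ \mathsf{do}\ \mathsf{skip},(s,h,(O\cup\{r\},L,D))\to_p\mathsf{skip},(s,h,(O,L,D\cup\{r\}))$; (BCT) $c,(s,h,\rho)\to_p\mathsf{skip},(s',h',\rho)$ if $[c](s,h)=(s',h')$. Abort: (RA) $\mathsf{resource}\ r$ with $r\in\rho$; (WA) $\mathsf{with}\ r$ with $r\notin\rho$; (RA1)/(RA2) body aborts under the configurations of (R1)/(R2); (BCA) $[c](s,h)=\mathsf{abort}$; (SA) first component of $;$ aborts; (WA1) body of $\mathsf{within}\ r$ aborts under $\rho\setminus\{r\}$; (WA2) $\mathsf{within}\ r$ with $r\notin O$; (PA1/PA2) a component of $\|$ aborts. A command is reachable if for some unextended $C_0$ there are states $\sigma,\sigma'$ and $k$ with $C_0,\sigma\to_p^kC',\sigma'$ and $C_0,\sigma\not\to_p^j\mathsf{abort}$ for $j\le k$. Environment: $(s,h,(O,L,D))\stackrel{A}{\leftrightsquigarrow}(s',h,(O,L',D'))$ iff $s(x)=s'(x)$ for $x\in A$ and $L'\cup D'=L\cup D$; with $A'=A\cup\bigcup_{r\in Locked(C)}PV(r)$, if $(s,h,\rho)\stackrel{A'}{\leftrightsquigarrow}(s',h,\rho')$, $\rho=(O,L,D)$, $\rho'=(O,L',D')$, $s,h_G\models\circledast_{r\in D}\Gamma(r)$, $s',h'_G\models\circledast_{r\in D'}\Gamma(r)$, then $C,(s,h\uplus h_G,\rho)\xrightarrow{A,\Gamma}_eC,(s',h\uplus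 h'_G,\rho')$; $\xrightarrow{A,\Gamma}=\to_p\cup\xrightarrow{A,\Gamma}_e$. $chng(C)$: variables $x$ such that the next transition of $C$ can execute $x:=e$, $x:=[e]$ or $x:=\mathsf{cons}(\dots)$. Safety: $\mathit{Safe}_0$ always holds; $\mathit{Safe}_{n+1}(C,s,h,\rho,\Gamma,Q,A)$, $\rho=(O,L,D)$, iff (i) $C=\mathsf{skip}\Rightarrow s,h\models Q$; (ii) $C,(s,h,\rho)\not\to_p\mathsf{abort}$; (iii) $chng(C)\cap\bigcup_{r\in L\cup D}PV(r)=\emptyset$; (iv) for every $h_G\bot h$ with $s,h_G\models\circledast_{r\in D}\Gamma(r)$ and every $C,(s,h\uplus h_G,\rho)\xrightarrow{A,\Gamma}C',(s',\hat h,\rho')$, $\rho'=(O',L',D')$, there exist $h',h'_G$ with $\hat h=h'\uplus h'_G$, $s',h'_G\models\circledast_{r\in D'}\Gamma(r)$ and $\mathit{Safe}_n(C',s',h',\rho',\Gamma,Q,A)$. -}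

module Defs where

open import Level using (Level; Lift; lift) renaming (suc to lsuc; zero to lzero)
open import Data.Nat as ℕ using (ℕ; zero; suc; _<_; _≤_)
open import Data.Integer as ℤ using (ℤ; +_)
open import Data.Bool using (Bool; true; false; if_then_else_; not; _∧_; _∨_)
open import Data.Maybe using (Maybe; just; nothing)
open import Data.List using (List; []; _∷_; _++_; length; map)
open import Data.List.Membership.Propositional using (_∈_)
open import Data.List.Membership.Propositional.Properties using (∈-++⁺ˡ; ∈-++⁺ʳ)
open import Data.List.Relation.Unary.Any using (Any; here; there)
open import Data.List.Relation.Unary.All using (All)
open import Data.Product using (Σ; _×_; _,_; ∃)
open import Data.Sum using (_⊎_; inj₁; inj₂)
open import Data.Empty using (⊥)
open import Data.Unit using (⊤)
open import Relation.Nullary using (¬_; Dec; yes; no; does)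
open import Relation.Binary.PropositionalEquality using (_≡_; _≢_; refl; sym)
open import Function using (_⇔_)

Var : Set
Var = ℕ

Val : Set
Val = ℤ

Loc : Set
Loc = ℤ

Store : Set
Store = Var → Val

_[_↦_] : Store → Var → Val → Store
(s [ x ↦ v ]) y = if does (y ℕ.≟ x) then v else s y

VarSet : Set₁
VarSet = Var → Set

_∪ᵥ_ : VarSet → VarSet → VarSet
(A ∪ᵥ B) x = A x ⊎ B x

_⊆ᵥ_ : VarSet → VarSet → Set
A ⊆ᵥ B = ∀ x → A x → B x

Disjointᵥ : VarSet → VarSet → Set
Disjointᵥ A B = ∀ x → A x → B x → ⊥

record Heap : Set where
  field
    fun : Loc → Maybe Val
    dom : List Loc
    fin : ∀ l v → fun l ≡ just v → l ∈ dom
open Heap public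

_≈ₕ_ : Heap → Heap → Set
h ≈ₕ g = ∀ l → fun h l ≡ fun g l

_⊥ₕ_ : Heap → Heap → Set
h ⊥ₕ g = ∀ l → fun h l ≡ nothing ⊎ fun g l ≡ nothing

_⊑ₕ_ : Heap → Heap → Set
h₁ ⊑ₕ h = ∀ l v → fun h₁ l ≡ just v → fun h l ≡ just v

emptyHeap : Heap
emptyHeap = record { fun = λ _ → nothing ; dom = [] ; fin = λ _ _ () }

private
  unionFun : (Loc → Maybe Val) → (Loc → Maybe Val) → Loc → Maybe Val
  unionFun f g l with f l
  ... | just v  = just v
  ... | nothing = g l

  unionFin : (h g : Heap) → ∀ l v → unionFun (fun h) (fun g) l ≡ just v → l ∈ (dom h ++ dom g)
  unionFin h g l v eq with fun h l in eqh
  ... | just w  = ∈-++⁺ˡ (fin h l w eqh)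
  ... | nothing = ∈-++⁺ʳ (dom h) (fin g l v eq)

-- union (it is the disjoint union h ⊎ g whenever h ⊥ₕ g)
_∪ₕ_ : Heap → Heap → Heap
h ∪ₕ g = record { fun = unionFun (fun h) (fun g) ; dom = dom h ++ dom g ; fin = unionFin h g }

private
  updFun : (Loc → Maybe Val) → Loc → Maybe Val → Loc → Maybe Val
  updFun f l m l' with l' ℤ.≟ l
  ... | yes _ = m
  ... | no  _ = f l'

  updFin : (h : Heap) (l : Loc) (v : Val) → ∀ l' w → updFun (fun h) l (just v) l' ≡ just w → l' ∈ (l ∷ dom h)
  updFin h l v l' w eq with l' ℤ.≟ l
  ... | yes p = here p
  ... | no  _ = there (fin h l' w eq)

  remFin : (h : Heap) (l : Loc) → ∀ l' w → updFun (fun h) l nothing l' ≡ just w → l' ∈ dom h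
  remFin h l l' w eq with l' ℤ.≟ l
  ... | yes _ with eq
  ...   | ()
  remFin h l l' w eq | no _ = fin h l' w eq

updateₕ : Heap → Loc → Val → Heap
updateₕ h l v = record { fun = updFun (fun h) l (just v) ; dom = l ∷ dom h ; fin = updFin h l v }

removeₕ : Heap → Loc → Heap
removeₕ h l = record { fun = updFun (fun h) l nothing ; dom = dom h ; fin = remFin h l }

allocₕ : Heap → Loc → List Val → Heap
allocₕ h l []       = h
allocₕ h l (v ∷ vs) = updateₕ (allocₕ h (l ℤ.+ + 1) vs) l v

data Exp : Set where
  var : Var → Exp
  lit : ℤ → Exp
  _⊕_ _⊖_ _⊗_ : Exp → Exp → Exp

data BExp : Set where
  btrue bfalse : BExp
  _==_ _<=_ : Exp → Exp → BExp
  bnot : BExp → BExp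
  _band_ _bor_ : BExp → BExp → BExp

⟦_⟧ₑ : Exp → Store → Val
⟦ var x ⟧ₑ s = s x
⟦ lit n ⟧ₑ s = n
⟦ e ⊕ e' ⟧ₑ s = ⟦ e ⟧ₑ s ℤ.+ ⟦ e' ⟧ₑ s
⟦ e ⊖ e' ⟧ₑ s = ⟦ e ⟧ₑ s ℤ.- ⟦ e' ⟧ₑ s
⟦ e ⊗ e' ⟧ₑ s = ⟦ e ⟧ₑ s ℤ.* ⟦ e' ⟧ₑ s

⟦_⟧ᵦ : BExp → Store → Bool
⟦ btrue ⟧ᵦ s = true
⟦ bfalse ⟧ᵦ s = false
⟦ e == e' ⟧ᵦ s = does (⟦ e ⟧ₑ s ℤ.≟ ⟦ e' ⟧ₑ s)
⟦ e <= e' ⟧ᵦ s = does (⟦ e ⟧ₑ s ℤ.≤? ⟦ e' ⟧ₑ s)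
⟦ bnot b ⟧ᵦ s = not (⟦ b ⟧ᵦ s)
⟦ b band b' ⟧ᵦ s = ⟦ b ⟧ᵦ s ∧ ⟦ b' ⟧ᵦ s
⟦ b bor b' ⟧ᵦ s = ⟦ b ⟧ᵦ s ∨ ⟦ b' ⟧ᵦ s

FVₑ : Exp → VarSet
FVₑ (var y) x = x ≡ y
FVₑ (lit _) x = ⊥
FVₑ (e ⊕ e') x = FVₑ e x ⊎ FVₑ e' x
FVₑ (e ⊖ e') x = FVₑ e x ⊎ FVₑ e' x
FVₑ (e ⊗ e') x = FVₑ e x ⊎ FVₑ e' x

FVᵦ : BExp → VarSet
FVᵦ btrue x = ⊥
FVᵦ bfalse x = ⊥
FVᵦ (e == e') x = FVₑ e x ⊎ FVₑ e' x
FVᵦ (e <= e') x = FVₑ e x ⊎ FVₑ e' x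
FVᵦ (bnot b) x = FVᵦ b x
FVᵦ (b band b') x = FVᵦ b x ⊎ FVᵦ b' x
FVᵦ (b bor b') x = FVᵦ b x ⊎ FVᵦ b' x

data Assn : Set where
  `bool : BExp → Assn                 -- pure boolean (includes true / false)
  `emp  : Assn
  _`↦_  : Exp → Exp → Assn
  _`∗_ _`-∗_ _`∧_ _`∨_ _`⇒_ : Assn → Assn → Assn
  `¬    : Assn → Assn
  `∃ `∀ : Var → Assn → Assn

_⊨_ : Store × Heap → Assn → Set
(s , h) ⊨ `bool b   = ⟦ b ⟧ᵦ s ≡ true
(s , h) ⊨ `emp      = ∀ l → fun h l ≡ nothing
(s , h) ⊨ (e `↦ e') = fun h (⟦ e ⟧ₑ s) ≡ just (⟦ e' ⟧ₑ s) × (∀ l → l ≢ ⟦ e ⟧ₑ s → fun h l ≡ nothing)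
(s , h) ⊨ (P `∗ Q)  = Σ Heap λ h₁ → Σ Heap λ h₂ → h₁ ⊥ₕ h₂ × h ≈ₕ (h₁ ∪ₕ h₂) × (s , h₁) ⊨ P × (s , h₂) ⊨ Q
(s , h) ⊨ (P `-∗ Q) = ∀ h' → h ⊥ₕ h' → (s , h') ⊨ P → (s , h ∪ₕ h') ⊨ Q
(s , h) ⊨ (P `∧ Q)  = (s , h) ⊨ P × (s , h) ⊨ Q
(s , h) ⊨ (P `∨ Q)  = (s , h) ⊨ P ⊎ (s , h) ⊨ Q
(s , h) ⊨ (P `⇒ Q)  = (s , h) ⊨ P → (s , h) ⊨ Q
(s , h) ⊨ `¬ P      = ¬ ((s , h) ⊨ P)
(s , h) ⊨ `∃ x P    = Σ Val λ v → (s [ x ↦ v ] , h) ⊨ P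
(s , h) ⊨ `∀ x P    = ∀ v → (s [ x ↦ v ] , h) ⊨ P

FV : Assn → VarSet
FV (`bool b) x = FVᵦ b x
FV `emp x = ⊥
FV (e `↦ e') x = FVₑ e x ⊎ FVₑ e' x
FV (P `∗ Q) x = FV P x ⊎ FV Q x
FV (P `-∗ Q) x = FV P x ⊎ FV Q x
FV (P `∧ Q) x = FV P x ⊎ FV Q x
FV (P `∨ Q) x = FV P x ⊎ FV Q x
FV (P `⇒ Q) x = FV P x ⊎ FV Q x
FV (`¬ P) x = FV P x
FV (`∃ y P) x = FV P x × x ≢ y
FV (`∀ y P) x = FV P x × x ≢ y

Precise : Assn → Set
Precise R = ∀ s h h₁ h₂ → h₁ ⊑ₕ h → h₂ ⊑ₕ h → (s , h₁) ⊨ R → (s , h₂) ⊨ R → h₁ ≈ₕ h₂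

RName : Set
RName = ℕ

RSet : Set₁
RSet = RName → Set

_∪ᵣ_ : RSet → RSet → RSet
(X ∪ᵣ Y) r = X r ⊎ Y r

⁅_⁆ : RName → RSet
⁅ r ⁆ r' = r' ≡ r

_∖ᵣ_ : RSet → RName → RSet
(X ∖ᵣ r) r' = X r' × r' ≢ r

∅ᵣ : RSet
∅ᵣ _ = ⊥

DisjointRS : RSet → RSet → Set
DisjointRS X Y = ∀ r → X r → Y r → ⊥

_≃ᵣ_ : RSet → RSet → Set
X ≃ᵣ Y = ∀ r → X r ⇔ Y r

record ResEntry : Set₁ where
  constructor entry
  field
    rname : RName
    pvars : VarSet
    inv   : Assn
open ResEntry public

ResCtx : Set₁
ResCtx = List ResEntry

NotNamed : RName → ResCtx → Set
NotNamed r [] = ⊤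
NotNamed r (e ∷ Γ) = rname e ≢ r × NotNamed r Γ

WFResCtx : ResCtx → Set
WFResCtx [] = ⊤
WFResCtx (e ∷ Γ) =
  NotNamed (rname e) Γ × Precise (inv e) × (FV (inv e) ⊆ᵥ pvars e) × WFResCtx Γ

-- PV(r)  (empty if r is not declared in Γ)
PV : ResCtx → RName → VarSet
PV [] r x = ⊥
PV (e ∷ Γ) r x = (rname e ≡ r × pvars e x) ⊎ PV Γ r x

PVs : ResCtx → RSet → VarSet
PVs Γ X x = Σ RName λ r → X r × PV Γ r x

-- s , h ⊨ ⊛_{r ∈ D} Γ(r)   (resources not declared in Γ contribute emp)
⊛sat : Store → Heap → ResCtx → RSet → Set
⊛sat s h [] D = ∀ l → fun h l ≡ nothing
⊛sat s h (e ∷ Γ) D =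
    (D (rname e) × Σ Heap λ h₁ → Σ Heap λ h₂ → h₁ ⊥ₕ h₂ × h ≈ₕ (h₁ ∪ₕ h₂) × (s , h₁) ⊨ inv e × ⊛sat s h₂ Γ D)
  ⊎ (¬ D (rname e) × ⊛sat s h Γ D)

record RConf : Set₁ where
  constructor ⟨_,_,_⟩
  field
    O L D : RSet
open RConf public

IsRConf : RConf → Set
IsRConf ρ = DisjointRS (O ρ) (L ρ) × DisjointRS (O ρ) (D ρ) × DisjointRS (L ρ) (D ρ)

_∈ρ_ : RName → RConf → Set
r ∈ρ ρ = O ρ r ⊎ L ρ r ⊎ D ρ r

_∖ρ_ : RConf → RName → RConf
⟨ O , L , D ⟩ ∖ρ r = ⟨ O ∖ᵣ r , L ∖ᵣ r , D ∖ᵣ r ⟩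

data BasicCmd : Set where
  _:=_      : Var → Exp → BasicCmd
  _:=[_]    : Var → Exp → BasicCmd
  [_]:=_    : Exp → Exp → BasicCmd
  _:=cons_  : Var → List Exp → BasicCmd
  dispose   : Exp → BasicCmd

data Cmd : Set where
  skip      : Cmd
  basic     : BasicCmd → Cmd
  _⨾_       : Cmd → Cmd → Cmd
  ifc_then_else_ : BExp → Cmd → Cmd → Cmd
  while_loop_ : BExp → Cmd → Cmd
  resource_inside_ : RName → Cmd → Cmd
  withr_when_exec_ : RName → BExp → Cmd → Cmd
  _∥_       : Cmd → Cmd → Cmd
  within_exec_ : RName → Cmd → Cmd

Unextended : Cmd → Set
Unextended skip = ⊤
Unextended (basic _) = ⊤
Unextended (C₁ ⨾ C₂) = Unextended C₁ × Unextended C₂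
Unextended (ifc _ then C₁ else C₂) = Unextended C₁ × Unextended C₂
Unextended (while _ loop C) = Unextended C
Unextended (resource _ inside C) = Unextended C
Unextended (withr _ when _ exec C) = Unextended C
Unextended (C₁ ∥ C₂) = Unextended C₁ × Unextended C₂
Unextended (within _ exec _) = ⊥

modBasic : BasicCmd → VarSet
modBasic (y := _) x = x ≡ y
modBasic (y :=[ _ ]) x = x ≡ y
modBasic ([ _ ]:= _) x = ⊥
modBasic (y :=cons _) x = x ≡ y
modBasic (dispose _) x = ⊥

mod : Cmd → VarSet
mod skip x = ⊥
mod (basic c) x = modBasic c x
mod (C₁ ⨾ C₂) x = mod C₁ x ⊎ mod C₂ x
mod (ifc _ then C₁ else C₂) x = mod C₁ x ⊎ mod C₂ x
mod (while _ loop C) x = mod C x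
mod (resource _ inside C) x = mod C x
mod (withr _ when _ exec C) x = mod C x
mod (C₁ ∥ C₂) x = mod C₁ x ⊎ mod C₂ x
mod (within _ exec C) x = mod C x

-- variables the next transition of C can assign
chng : Cmd → VarSet
chng (basic c) x = modBasic c x
chng (C₁ ⨾ C₂) x = chng C₁ x
chng (C₁ ∥ C₂) x = chng C₁ x ⊎ chng C₂ x
chng (resource _ inside C) x = chng C x
chng (within _ exec C) x = chng C x
chng _ x = ⊥

Locked : Cmd → RSet
Locked (C₁ ⨾ C₂) r = Locked C₁ r
Locked (C₁ ∥ C₂) r = Locked C₁ r ⊎ Locked C₂ r
Locked (resource r' inside C) r = Locked C r × r ≢ r'
Locked (within r' exec C) r = Locked C r ⊎ r ≡ r'
Locked _ r = ⊥

data BasicStep : BasicCmd → Store → Heap → Store → Heap → Set where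
  bs-assign  : ∀ {x e s h} → BasicStep (x := e) s h (s [ x ↦ ⟦ e ⟧ₑ s ]) h
  bs-lookup  : ∀ {x e s h v} → fun h (⟦ e ⟧ₑ s) ≡ just v →
               BasicStep (x :=[ e ]) s h (s [ x ↦ v ]) h
  bs-mutate  : ∀ {e e' s h v} → fun h (⟦ e ⟧ₑ s) ≡ just v →
               BasicStep ([ e ]:= e') s h s (updateₕ h (⟦ e ⟧ₑ s) (⟦ e' ⟧ₑ s))
  bs-cons    : ∀ {x es s h} (l : Loc) →
               (∀ i → i < length es → fun h (l ℤ.+ + i) ≡ nothing) →
               BasicStep (x :=cons es) s h (s [ x ↦ l ]) (allocₕ h l (map (λ e → ⟦ e ⟧ₑ s) es))
  bs-dispose : ∀ {e s h v} → fun h (⟦ e ⟧ₑ s) ≡ just v →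
               BasicStep (dispose e) s h s (removeₕ h (⟦ e ⟧ₑ s))

data BasicAbort : BasicCmd → Store → Heap → Set where
  ba-lookup  : ∀ {x e s h} → fun h (⟦ e ⟧ₑ s) ≡ nothing → BasicAbort (x :=[ e ]) s h
  ba-mutate  : ∀ {e e' s h} → fun h (⟦ e ⟧ₑ s) ≡ nothing → BasicAbort ([ e ]:= e') s h
  ba-dispose : ∀ {e s h} → fun h (⟦ e ⟧ₑ s) ≡ nothing → BasicAbort (dispose e) s h

data _,_,_,_⟶ₚ_,_,_,_ : Cmd → Store → Heap → RConf → Cmd → Store → Heap → RConf → Set₁ where
  S1  : ∀ {C₂ s h ρ} → (skip ⨾ C₂) , s , h , ρ ⟶ₚ C₂ , s , h , ρ
  S2  : ∀ {C₁ C₁' C₂ s h ρ s' h' ρ'} → C₁ , s , h , ρ ⟶ₚ C₁' , s' , h' , ρ' →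
        (C₁ ⨾ C₂) , s , h , ρ ⟶ₚ (C₁' ⨾ C₂) , s' , h' , ρ'
  LP  : ∀ {B C s h ρ} →
        (while B loop C) , s , h , ρ ⟶ₚ (ifc B then (C ⨾ (while B loop C)) else skip) , s , h , ρ
  IF1 : ∀ {B C₁ C₂ s h ρ} → ⟦ B ⟧ᵦ s ≡ true → (ifc B then C₁ else C₂) , s , h , ρ ⟶ₚ C₁ , s , h , ρ
  IF2 : ∀ {B C₁ C₂ s h ρ} → ⟦ B ⟧ᵦ s ≡ false → (ifc B then C₁ else C₂) , s , h , ρ ⟶ₚ C₂ , s , h , ρ
  P1  : ∀ {C₁ C₁' C₂ s h ρ s' h' ρ'} → C₁ , s , h , ρ ⟶ₚ C₁' , s' , h' , ρ' →
        (C₁ ∥ C₂) , s , h , ρ ⟶ₚ (C₁' ∥ C₂) , s' , h' , ρ'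
  P2  : ∀ {C₁ C₂ C₂' s h ρ s' h' ρ'} → C₂ , s , h , ρ ⟶ₚ C₂' , s' , h' , ρ' →
        (C₁ ∥ C₂) , s , h , ρ ⟶ₚ (C₁ ∥ C₂') , s' , h' , ρ'
  P3  : ∀ {s h ρ} → (skip ∥ skip) , s , h , ρ ⟶ₚ skip , s , h , ρ
  R0  : ∀ {r s h ρ} → ¬ (r ∈ρ ρ) → (resource r inside skip) , s , h , ρ ⟶ₚ skip , s , h , ρ
  R1  : ∀ {r C C' s h O L D s' h' ρ'} → ¬ (r ∈ρ ⟨ O , L , D ⟩) → Locked C r →
        C , s , h , ⟨ O ∪ᵣ ⁅ r ⁆ , L , D ⟩ ⟶ₚ C' , s' , h' , ρ' →
        (resource r inside C) , s , h , ⟨ O , L , D ⟩ ⟶ₚ (resource r inside C') , s' , h' , (ρ' ∖ρ r)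
  R2  : ∀ {r C C' s h O L D s' h' ρ'} → ¬ (r ∈ρ ⟨ O , L , D ⟩) → ¬ Locked C r →
        C , s , h , ⟨ O , L , D ∪ᵣ ⁅ r ⁆ ⟩ ⟶ₚ C' , s' , h' , ρ' →
        (resource r inside C) , s , h , ⟨ O , L , D ⟩ ⟶ₚ (resource r inside C') , s' , h' , (ρ' ∖ρ r)
  W0  : ∀ {r B C s h O L D} → D r → ⟦ B ⟧ᵦ s ≡ true →
        (withr r when B exec C) , s , h , ⟨ O , L , D ⟩ ⟶ₚ (within r exec C) , s , h , ⟨ O ∪ᵣ ⁅ r ⁆ , L , D ∖ᵣ r ⟩
  W1  : ∀ {r C C' s h O L D s' h' O' L' D'} → O r →
        C , s , h , ⟨ O ∖ᵣ r , L , D ⟩ ⟶ₚ C' , s' , h' , ⟨ O' , L' , D' ⟩ →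
        (within r exec C) , s , h , ⟨ O , L , D ⟩ ⟶ₚ (within r exec C') , s' , h' , ⟨ O' ∪ᵣ ⁅ r ⁆ , L' , D' ⟩
  W2  : ∀ {r s h O L D} → O r →
        (within r exec skip) , s , h , ⟨ O , L , D ⟩ ⟶ₚ skip , s , h , ⟨ O ∖ᵣ r , L , D ∪ᵣ ⁅ r ⁆ ⟩
  BCT : ∀ {c s h ρ s' h'} → BasicStep c s h s' h' → basic c , s , h , ρ ⟶ₚ skip , s' , h' , ρ

data _,_,_,_⟶abort : Cmd → Store → Heap → RConf → Set₁ where
  RA  : ∀ {r C s h ρ} → r ∈ρ ρ → (resource r inside C) , s , h , ρ ⟶abort
  WA  : ∀ {r B C s h ρ} → ¬ (r ∈ρ ρ) → (withr r when B exec C) , s , h , ρ ⟶abort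
  RA1 : ∀ {r C s h O L D} → ¬ (r ∈ρ ⟨ O , L , D ⟩) → Locked C r →
        C , s , h , ⟨ O ∪ᵣ ⁅ r ⁆ , L , D ⟩ ⟶abort → (resource r inside C) , s , h , ⟨ O , L , D ⟩ ⟶abort
  RA2 : ∀ {r C s h O L D} → ¬ (r ∈ρ ⟨ O , L , D ⟩) → ¬ Locked C r →
        C , s , h , ⟨ O , L , D ∪ᵣ ⁅ r ⁆ ⟩ ⟶abort → (resource r inside C) , s , h , ⟨ O , L , D ⟩ ⟶abort
  BCA : ∀ {c s h ρ} → BasicAbort c s h → basic c , s , h , ρ ⟶abort
  SA  : ∀ {C₁ C₂ s h ρ} → C₁ , s , h , ρ ⟶abort → (C₁ ⨾ C₂) , s , h , ρ ⟶abort
  WA1 : ∀ {r C s h ρ} → C , s , h , (ρ ∖ρ r) ⟶abort → (within r exec C) , s , h , ρ ⟶abort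
  WA2 : ∀ {r C s h ρ} → ¬ (O ρ r) → (within r exec C) , s , h , ρ ⟶abort
  PA1 : ∀ {C₁ C₂ s h ρ} → C₁ , s , h , ρ ⟶abort → (C₁ ∥ C₂) , s , h , ρ ⟶abort
  PA2 : ∀ {C₁ C₂ s h ρ} → C₂ , s , h , ρ ⟶abort → (C₁ ∥ C₂) , s , h , ρ ⟶abort

data _,_,_,_⟶ₚ[_]_,_,_,_ : Cmd → Store → Heap → RConf → ℕ → Cmd → Store → Heap → RConf → Set₁ where
  done : ∀ {C s h ρ} → C , s , h , ρ ⟶ₚ[ 0 ] C , s , h , ρ
  step : ∀ {C s h ρ C₁ s₁ h₁ ρ₁ k C' s' h' ρ'} →
         C , s , h , ρ ⟶ₚ C₁ , s₁ , h₁ , ρ₁ → C₁ , s₁ , h₁ , ρ₁ ⟶ₚ[ k ] C' , s' , h' , ρ' →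
         C , s , h , ρ ⟶ₚ[ suc k ] C' , s' , h' , ρ'

-- C , σ →ₚʲ abort   (j ≥ 1: j-1 ordinary steps followed by an aborting step)
AbortsIn : ℕ → Cmd → Store → Heap → RConf → Set₁
AbortsIn zero C s h ρ = Lift _ ⊥
AbortsIn (suc j) C s h ρ =
  Σ Cmd λ C'' → Σ Store λ s'' → Σ Heap λ h'' → Σ RConf λ ρ'' →
    (C , s , h , ρ ⟶ₚ[ j ] C'' , s'' , h'' , ρ'') × (C'' , s'' , h'' , ρ'' ⟶abort)

Reachable : Cmd → Set₁
Reachable C' =
  Σ Cmd λ C₀ → Unextended C₀ × Σ Store λ s → Σ Heap λ h → Σ RConf λ ρ → IsRConf ρ ×
  Σ Store λ s' → Σ Heap λ h' → Σ RConf λ ρ' → Σ ℕ λ k →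
    (C₀ , s , h , ρ ⟶ₚ[ k ] C' , s' , h' , ρ') × (∀ j → j ≤ k → ¬ AbortsIn j C₀ s h ρ)

AgreeOn : VarSet → Store → Store → Set
AgreeOn A s s' = ∀ x → A x → s x ≡ s' x

data EnvStep (A : VarSet) (Γ : ResCtx) (C : Cmd) : Store → Heap → RConf → Store → Heap → RConf → Set₁ where
  env : ∀ {s s' h hG hG' O L D L' D'} →
        h ⊥ₕ hG → h ⊥ₕ hG' →
        AgreeOn (A ∪ᵥ PVs Γ (Locked C)) s s' →
        (L' ∪ᵣ D') ≃ᵣ (L ∪ᵣ D) →
        IsRConf ⟨ O , L' , D' ⟩ →
        ⊛sat s hG Γ D → ⊛sat s' hG' Γ D' →
        EnvStep A Γ C s (h ∪ₕ hG) ⟨ O , L , D ⟩ s' (h ∪ₕ hG') ⟨ O , L' , D' ⟩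

data Trans (A : VarSet) (Γ : ResCtx) : Cmd → Store → Heap → RConf → Cmd → Store → Heap → RConf → Set₁ where
  prog : ∀ {C s h ρ C' s' h' ρ'} → C , s , h , ρ ⟶ₚ C' , s' , h' , ρ' → Trans A Γ C s h ρ C' s' h' ρ'
  envt : ∀ {C s h ρ s' h' ρ'} → EnvStep A Γ C s h ρ s' h' ρ' → Trans A Γ C s h ρ C s' h' ρ'

Safe : ℕ → Cmd → Store → Heap → RConf → ResCtx → Assn → VarSet → Set₁
Safe zero C s h ρ Γ Q A = Lift _ ⊤
Safe (suc n) C s h ρ Γ Q A =
    (C ≡ skip → (s , h) ⊨ Q)
  × ¬ (C , s , h , ρ ⟶abort)
  × Disjointᵥ (chng C) (PVs Γ (L ρ ∪ᵣ D ρ))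
  × (∀ hG → h ⊥ₕ hG → ⊛sat s hG Γ (D ρ) →
       ∀ C' s' ĥ ρ' → Trans A Γ C s (h ∪ₕ hG) ρ C' s' ĥ ρ' →
       Σ Heap λ h' → Σ Heap λ hG' → h' ⊥ₕ hG' × ĥ ≈ₕ (h' ∪ₕ hG') ×
         ⊛sat s' hG' Γ (D ρ') × Safe n C' s' h' ρ' Γ Q A)

module Submission where

-- A transition of C₁ ∥ C₂ is a step of one thread, an environment step, or the
-- final join. By the frame property, a step of C₁ on h₁ ∪ h₂ ∪ hG is a step on
-- h₁ ∪ hG in C₁'s view of the configuration, where the resources owned by C₂
-- count as locked; safety of C₁ then splits the result into a new local and
-- shared heap. For C₂ the same step is an environment step: C₁ writes neither
-- A₂ (disjoint from mod C₁) nor the variables protected by resources C₂ is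
-- inside (C₂ owns them, so they are locked for C₁), and precision of the
-- invariants shows that h₂ is unchanged. Environment steps of C₁ ∥ C₂ are
-- environment steps of both threads.

open import Defs
open import Level using (0ℓ; lift)
open import Data.Nat as ℕ using (ℕ; zero; suc; _<_; s≤s; z≤n)
open import Data.Integer as ℤ using (+_)
import Data.Integer.Properties as ℤ
open import Data.Bool using (if_then_else_; not; _∧_; _∨_)
open import Data.Maybe using (Maybe; just; nothing; _<∣>_)
open import Data.Maybe.Properties using (<∣>-assoc; <∣>-identityʳ)
open import Data.List using ([]; _∷_; length; map)
open import Data.List.Properties using (length-map)
open import Data.Product using (Σ; _×_; _,_; proj₁; proj₂)
open import Data.Sum using (_⊎_; inj₁; inj₂)
import Data.Sum as ⊎
open import Function using (id; _∘_; flip; case_of_)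
open import Function.Bundles using (module Equivalence; mk⇔)
import Function.Properties.Equivalence as ⇔
open Equivalence using (to; from)
open import Data.Empty using (⊥; ⊥-elim)
open import Relation.Nullary using (¬_; yes; no; does)
open import Relation.Nullary.Decidable using (dec-true; dec-false; ¬¬-excluded-middle)
open import Relation.Binary.Bundles using (Setoid)
open import Relation.Binary.PropositionalEquality
import Relation.Binary.Reasoning.Setoid as SetoidReasoning

Apart : Maybe Val → Maybe Val → Set
Apart x y = x ≡ nothing ⊎ y ≡ nothing

<∣>-comm-apart : ∀ x y → Apart x y → x <∣> y ≡ y <∣> x
<∣>-comm-apart (just _) (just _) (inj₁ ())
<∣>-comm-apart (just _) (just _) (inj₂ ())
<∣>-comm-apart (just _) nothing  _ = refl
<∣>-comm-apart nothing  y        _ = sym (<∣>-identityʳ y)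

<∣>-conical : ∀ (x y : Maybe Val) → x <∣> y ≡ nothing → x ≡ nothing × y ≡ nothing
<∣>-conical nothing y eq = refl , eq

<∣>-cancelʳ : ∀ x z y → x <∣> y ≡ z <∣> y → Apart x y → Apart z y → x ≡ z
<∣>-cancelʳ (just _) (just _) y  eq _ _ = eq
<∣>-cancelʳ nothing  nothing  y  eq _ _ = refl
<∣>-cancelʳ (just _) nothing  _  eq (inj₂ refl) _ = eq
<∣>-cancelʳ nothing  (just _) _  eq _ (inj₂ refl) = eq
<∣>-cancelʳ (just _) nothing  _  eq (inj₁ ()) _
<∣>-cancelʳ nothing  (just _) _  eq _ (inj₁ ())

<∣>-justʳ : ∀ {x y v} → Apart x y → y ≡ just v → x <∣> y ≡ just v
<∣>-justʳ (inj₁ refl) e = e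
<∣>-justʳ (inj₂ refl) ()

<∣>-apart : ∀ {x y z} → Apart x z → Apart y z → Apart (x <∣> y) z
<∣>-apart (inj₁ refl) q = q
<∣>-apart (inj₂ e)    _ = inj₂ e

fun-∪ₕ : ∀ h g l → fun (h ∪ₕ g) l ≡ fun h l <∣> fun g l
fun-∪ₕ h g l with fun h l
... | just _  = refl
... | nothing = refl

-- The relations of Defs, wrapped in records so that the heaps they relate
-- are inferable from a proof's type.
record _≈_ (h g : Heap) : Set where
  constructor mk≈
  field un≈ : h ≈ₕ g

record _#_ (h g : Heap) : Set where
  constructor mk#
  field un# : h ⊥ₕ g

record _⊑_ (h g : Heap) : Set where
  constructor mk⊑
  field un⊑ : h ⊑ₕ g

open _≈_ public
open _#_ public
open _⊑_ public

infix 4 _≈_ _#_ _⊑_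

≈-refl : ∀ {h} → h ≈ h
≈-refl = mk≈ λ _ → refl

≈-sym : ∀ {h g} → h ≈ g → g ≈ h
≈-sym (mk≈ p) = mk≈ λ l → sym (p l)

≈-trans : ∀ {h g k} → h ≈ g → g ≈ k → h ≈ k
≈-trans (mk≈ p) (mk≈ q) = mk≈ λ l → trans (p l) (q l)

≈-setoid : Setoid 0ℓ 0ℓ
≈-setoid = record
  { Carrier = Heap ; _≈_ = _≈_
  ; isEquivalence = record { refl = ≈-refl ; sym = ≈-sym ; trans = ≈-trans } }

module ≈-Reasoning = SetoidReasoning ≈-setoid

∪-cong : ∀ {a a' b b'} → a ≈ a' → b ≈ b' → a ∪ₕ b ≈ a' ∪ₕ b'
∪-cong {a} {a'} {b} {b'} (mk≈ p) (mk≈ q) = mk≈ λ l → begin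
  fun (a ∪ₕ b) l             ≡⟨ fun-∪ₕ a b l ⟩
  fun a l <∣> fun b l         ≡⟨ cong₂ _<∣>_ (p l) (q l) ⟩
  fun a' l <∣> fun b' l       ≡⟨ sym (fun-∪ₕ a' b' l) ⟩
  fun (a' ∪ₕ b') l           ∎
  where open ≡-Reasoning

∪-congʳ : ∀ a {b b'} → b ≈ b' → a ∪ₕ b ≈ a ∪ₕ b'
∪-congʳ a = ∪-cong (≈-refl {a})

∪-congˡ : ∀ {a a'} b → a ≈ a' → a ∪ₕ b ≈ a' ∪ₕ b
∪-congˡ b p = ∪-cong p (≈-refl {b})

∪-assoc : ∀ a b c → (a ∪ₕ b) ∪ₕ c ≈ a ∪ₕ (b ∪ₕ c)
∪-assoc a b c = mk≈ λ l → begin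
  fun ((a ∪ₕ b) ∪ₕ c) l               ≡⟨ fun-∪ₕ (a ∪ₕ b) c l ⟩
  fun (a ∪ₕ b) l <∣> fun c l           ≡⟨ cong (_<∣> fun c l) (fun-∪ₕ a b l) ⟩
  (fun a l <∣> fun b l) <∣> fun c l    ≡⟨ <∣>-assoc (fun a l) (fun b l) (fun c l) ⟩
  fun a l <∣> (fun b l <∣> fun c l)    ≡⟨ cong (fun a l <∣>_) (sym (fun-∪ₕ b c l)) ⟩
  fun a l <∣> fun (b ∪ₕ c) l           ≡⟨ sym (fun-∪ₕ a (b ∪ₕ c) l) ⟩
  fun (a ∪ₕ (b ∪ₕ c)) l               ∎
  where open ≡-Reasoning

∪-comm : ∀ {a b} → a # b → a ∪ₕ b ≈ b ∪ₕ a
∪-comm {a} {b} (mk# d) = mk≈ λ l →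
  trans (fun-∪ₕ a b l) (trans (<∣>-comm-apart _ _ (d l)) (sym (fun-∪ₕ b a l)))

∪-cancelʳ : ∀ {a b c d} → a ∪ₕ b ≈ c ∪ₕ d → a # b → c # d → b ≈ d → a ≈ c
∪-cancelʳ {a} {b} {c} {d} (mk≈ p) (mk# ab) (mk# cd) (mk≈ bd) = mk≈ λ l →
  <∣>-cancelʳ (fun a l) (fun c l) (fun b l)
    (trans (sym (fun-∪ₕ a b l)) (trans (p l) (trans (fun-∪ₕ c d l) (cong (fun c l <∣>_) (sym (bd l))))))
    (ab l) (subst (Apart (fun c l)) (sym (bd l)) (cd l))

#-sym : ∀ {a b} → a # b → b # a
#-sym (mk# d) = mk# λ l → ⊎.swap (d l)

#-cong : ∀ {a a' b b'} → a ≈ a' → b ≈ b' → a # b → a' # b'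
#-cong (mk≈ p) (mk≈ q) (mk# d) = mk# λ l →
  ⊎.map (trans (sym (p l))) (trans (sym (q l))) (d l)

⊑-refl : ∀ {a} → a ⊑ a
⊑-refl = mk⊑ λ _ _ e → e

⊑-trans : ∀ {a b c} → a ⊑ b → b ⊑ c → a ⊑ c
⊑-trans (mk⊑ p) (mk⊑ q) = mk⊑ λ l v e → q l v (p l v e)

≈⇒⊑ : ∀ {a b} → a ≈ b → a ⊑ b
≈⇒⊑ (mk≈ p) = mk⊑ λ l v e → trans (sym (p l)) e

⊑-∪ˡ : ∀ {a b} → a ⊑ a ∪ₕ b
⊑-∪ˡ {a} {b} = mk⊑ λ l v e → trans (fun-∪ₕ a b l) (cong (_<∣> fun b l) e)

⊑-∪ʳ : ∀ {a b} → a # b → b ⊑ a ∪ₕ b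
⊑-∪ʳ {a} {b} (mk# d) = mk⊑ λ l v e → trans (fun-∪ₕ a b l) (<∣>-justʳ (d l) e)

⊑-respects-nothing : ∀ {a b} → a ⊑ b → ∀ l → fun b l ≡ nothing → fun a l ≡ nothing
⊑-respects-nothing {a} (mk⊑ p) l e with fun a l in eq
... | nothing = refl
... | just v with () ← trans (sym (p l v eq)) e

#-monoˡ : ∀ {a b c} → a ⊑ b → b # c → a # c
#-monoˡ sub (mk# d) = mk# λ l → ⊎.map₁ (⊑-respects-nothing sub l) (d l)

∪-# : ∀ {a b c} → a # c → b # c → a ∪ₕ b # c
∪-# {a} {b} {c} (mk# p) (mk# q) = mk# λ l →
  subst (λ u → Apart u (fun c l)) (sym (fun-∪ₕ a b l)) (<∣>-apart (p l) (q l))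

partˡ : ∀ {h a b} → h ≈ a ∪ₕ b → a ⊑ h
partˡ p = ⊑-trans ⊑-∪ˡ (≈⇒⊑ (≈-sym p))

partʳ : ∀ {h a b} → a # b → h ≈ a ∪ₕ b → b ⊑ h
partʳ d p = ⊑-trans (⊑-∪ʳ d) (≈⇒⊑ (≈-sym p))

∪-swapʳ : ∀ a {b c} → b # c → (a ∪ₕ b) ∪ₕ c ≈ (a ∪ₕ c) ∪ₕ b
∪-swapʳ a {b} {c} d = begin
  (a ∪ₕ b) ∪ₕ c    ≈⟨ ∪-assoc a b c ⟩
  a ∪ₕ (b ∪ₕ c)    ≈⟨ ∪-congʳ a (∪-comm d) ⟩
  a ∪ₕ (c ∪ₕ b)    ≈⟨ ≈-sym (∪-assoc a c b) ⟩
  (a ∪ₕ c) ∪ₕ b    ∎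
  where open ≈-Reasoning

reassemble : ∀ {X Y a g b b'} → X ≈ Y ∪ₕ b → Y ≈ a ∪ₕ g → a # g → Y # b → b ≈ b' →
  a # b' × a ∪ₕ b' # g × X ≈ (a ∪ₕ b') ∪ₕ g
reassemble {X} {Y} {a} {g} {b} {b'} X≈ Y≈ a#g Y#b b≈b' =
  #-cong ≈-refl b≈b' a#b , ∪-# a#g (#-cong b≈b' ≈-refl b#g) , X≈'
  where
  a#b : a # b
  a#b = #-monoˡ (partˡ Y≈) Y#b
  b#g : b # g
  b#g = #-sym (#-monoˡ (partʳ a#g Y≈) Y#b)
  open ≈-Reasoning
  X≈' : X ≈ (a ∪ₕ b') ∪ₕ g
  X≈' = begin
    X                ≈⟨ X≈ ⟩
    Y ∪ₕ b           ≈⟨ ∪-congˡ b Y≈ ⟩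
    (a ∪ₕ g) ∪ₕ b    ≈⟨ ∪-swapʳ a (#-sym b#g) ⟩
    (a ∪ₕ b) ∪ₕ g    ≈⟨ ∪-congˡ g (∪-congʳ a b≈b') ⟩
    (a ∪ₕ b') ∪ₕ g   ∎

-- Frame property of basic commands

_[_≔_]ᶠ : (Loc → Maybe Val) → Loc → Maybe Val → Loc → Maybe Val
(f [ l ≔ m ]ᶠ) l' = if does (l' ℤ.≟ l) then m else f l'

fun-updateₕ : ∀ h l v l' → fun (updateₕ h l v) l' ≡ (fun h [ l ≔ just v ]ᶠ) l'
fun-updateₕ h l v l' with l' ℤ.≟ l
... | yes _ = refl
... | no  _ = refl

fun-removeₕ : ∀ h l l' → fun (removeₕ h l) l' ≡ (fun h [ l ≔ nothing ]ᶠ) l'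
fun-removeₕ h l l' with l' ℤ.≟ l
... | yes _ = refl
... | no  _ = refl

overwrite-frame : ∀ {X Y Z X' Y'} l m → X ≈ Y ∪ₕ Z → Y # Z → fun Z l ≡ nothing →
  (∀ l' → fun X' l' ≡ (fun X [ l ≔ m ]ᶠ) l') → (∀ l' → fun Y' l' ≡ (fun Y [ l ≔ m ]ᶠ) l') →
  X' ≈ Y' ∪ₕ Z × Y' # Z
overwrite-frame {X} {Y} {Z} {X'} {Y'} l m (mk≈ p) (mk# d) zn eX eY =
  mk≈ (λ l' → trans (split l') (sym (fun-∪ₕ Y' Z l'))) , mk# apart
  where
  split : ∀ l' → fun X' l' ≡ fun Y' l' <∣> fun Z l'
  split l' with l' ℤ.≟ l | eX l' | eY l'
  ... | yes refl | ex | ey = trans ex (sym (trans (cong₂ _<∣>_ ey zn) (<∣>-identityʳ m)))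
  ... | no _     | ex | ey =
    trans ex (trans (p l') (trans (fun-∪ₕ Y Z l') (cong (_<∣> fun Z l') (sym ey))))
  apart : ∀ l' → Apart (fun Y' l') (fun Z l')
  apart l' with l' ℤ.≟ l | eY l'
  ... | yes refl | _  = inj₂ zn
  ... | no _     | ey = ⊎.map₁ (trans ey) (d l')

update-frame : ∀ {X Y Z} l v → X ≈ Y ∪ₕ Z → Y # Z → fun Z l ≡ nothing →
  updateₕ X l v ≈ updateₕ Y l v ∪ₕ Z × updateₕ Y l v # Z
update-frame {X} {Y} l v p d zn =
  overwrite-frame l (just v) p d zn (fun-updateₕ X l v) (fun-updateₕ Y l v)

remove-frame : ∀ {X Y Z} l → X ≈ Y ∪ₕ Z → Y # Z → fun Z l ≡ nothing →
  removeₕ X l ≈ removeₕ Y l ∪ₕ Z × removeₕ Y l # Z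
remove-frame {X} {Y} l p d zn =
  overwrite-frame l nothing p d zn (fun-removeₕ X l) (fun-removeₕ Y l)

alloc-frame : ∀ {X Y Z} l vs → X ≈ Y ∪ₕ Z → Y # Z →
  (∀ i → i < length vs → fun Z (l ℤ.+ + i) ≡ nothing) →
  allocₕ X l vs ≈ allocₕ Y l vs ∪ₕ Z × allocₕ Y l vs # Z
alloc-frame l []       p d zn = p , d
alloc-frame {Z = Z} l (v ∷ vs) p d zn =
  let p' , d' = alloc-frame (l ℤ.+ + 1) vs p d λ i i<n →
                  subst (λ k → fun Z k ≡ nothing) (sym (ℤ.+-assoc l (+ 1) (+ i))) (zn (suc i) (s≤s i<n))
  in update-frame l v p' d' (subst (λ k → fun Z k ≡ nothing) (ℤ.+-identityʳ l) (zn 0 (s≤s z≤n)))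

part-allocated : ∀ {X Y Z Y₀} l v → X ≈ Y ∪ₕ Z → Y₀ ⊑ Y → ¬ fun Y₀ l ≡ nothing →
  fun X l ≡ just v → fun Y l ≡ just v
part-allocated {X} {Y} {Z} {Y₀} l v (mk≈ p) (mk⊑ sub) undef eX with fun Y₀ l in eq
... | nothing = ⊥-elim (undef refl)
... | just w  =
  trans eY (sym (trans (sym eX) (trans (p l) (trans (fun-∪ₕ Y Z l) (cong (_<∣> fun Z l) eY)))))
  where
  eY : fun Y l ≡ just w
  eY = sub l w eq

disjoint-unallocated : ∀ {Y Z} l {v} → Y # Z → fun Y l ≡ just v → fun Z l ≡ nothing
disjoint-unallocated l (mk# d) eY with d l
... | inj₁ e = case trans (sym eY) e of λ ()
... | inj₂ e = e

basic-frame : ∀ {c s X s' X' Y Z Y₀} → BasicStep c s X s' X' → X ≈ Y ∪ₕ Z → Y # Z → Y₀ ⊑ Y →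
  ¬ BasicAbort c s Y₀ → Σ Heap λ Y' → BasicStep c s Y s' Y' × X' ≈ Y' ∪ₕ Z × Y' # Z
basic-frame {Y = Y} bs-assign p d sub safe = Y , bs-assign , p , d
basic-frame {s = s} {Y = Y} (bs-lookup {e = e} {v = v} eX) p d sub safe =
  Y , bs-lookup (part-allocated (⟦ e ⟧ₑ s) v p sub (safe ∘ ba-lookup) eX) , p , d
basic-frame {s = s} {Y = Y} (bs-mutate {e = e} {e' = e'} {v = v} eX) p d sub safe =
  let eY = part-allocated (⟦ e ⟧ₑ s) v p sub (safe ∘ ba-mutate) eX
  in _ , bs-mutate eY , update-frame _ (⟦ e' ⟧ₑ s) p d (disjoint-unallocated _ d eY)
basic-frame {s = s} {Y = Y} (bs-dispose {e = e} {v = v} eX) p d sub safe =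
  let eY = part-allocated (⟦ e ⟧ₑ s) v p sub (safe ∘ ba-dispose) eX
  in _ , bs-dispose eY , remove-frame _ p d (disjoint-unallocated _ d eY)
basic-frame {s = s} {Y = Y} {Z} (bs-cons {es = es} l free) (mk≈ p) d sub safe =
  _ , bs-cons l (λ i i<n → proj₁ (free-parts i i<n)) ,
  alloc-frame l (map (λ e → ⟦ e ⟧ₑ s) es) (mk≈ p) d
    (λ i i<n → proj₂ (free-parts i (subst (i <_) (length-map _ es) i<n)))
  where
  free-parts : ∀ i → i < length es → fun Y (l ℤ.+ + i) ≡ nothing × fun Z (l ℤ.+ + i) ≡ nothing
  free-parts i i<n = <∣>-conical _ _
    (trans (sym (fun-∪ₕ Y Z _)) (trans (sym (p _)) (free i i<n)))

-- ρ₁ is how a thread sees ρ while its sibling owns O₂: the sibling's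
-- resources count as locked.
record View (O₂ : RSet) (ρ ρ₁ : RConf) : Set where
  field
    O⊆O₁∪O₂ : ∀ r → O ρ r → O ρ₁ r ⊎ O₂ r
    O₁⊆O    : ∀ r → O ρ₁ r → O ρ r
    O₂⊆O    : ∀ r → O₂ r → O ρ r
    L₁⊆L∪O₂ : ∀ r → L ρ₁ r → L ρ r ⊎ O₂ r
    L⊆L₁    : ∀ r → L ρ r → L ρ₁ r
    O₂⊆L₁   : ∀ r → O₂ r → L ρ₁ r
    D⊆D₁    : ∀ r → D ρ r → D ρ₁ r
    D₁⊆D    : ∀ r → D ρ₁ r → D ρ r
    O₁#O₂   : DisjointRS (O ρ₁) O₂
open View public

∈-view : ∀ {O₂ ρ ρ₁ r} → View O₂ ρ ρ₁ → r ∈ρ ρ → r ∈ρ ρ₁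
∈-view {r = r} V (inj₁ o) = ⊎.map₂ (inj₁ ∘ O₂⊆L₁ V r) (O⊆O₁∪O₂ V r o)
∈-view {r = r} V (inj₂ (inj₁ l)) = inj₂ (inj₁ (L⊆L₁ V r l))
∈-view {r = r} V (inj₂ (inj₂ d)) = inj₂ (inj₂ (D⊆D₁ V r d))

∈-unview : ∀ {O₂ ρ ρ₁ r} → View O₂ ρ ρ₁ → r ∈ρ ρ₁ → r ∈ρ ρ
∈-unview {r = r} V (inj₁ o) = inj₁ (O₁⊆O V r o)
∈-unview {r = r} V (inj₂ (inj₁ l)) = ⊎.[ inj₂ ∘ inj₁ , inj₁ ∘ O₂⊆O V r ] (L₁⊆L∪O₂ V r l)
∈-unview {r = r} V (inj₂ (inj₂ d)) = inj₂ (inj₂ (D₁⊆D V r d))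

owned-in-view : ∀ {O₂ ρ ρ₁ r} → View O₂ ρ ρ₁ → O ρ r → ¬ ¬ O ρ₁ r → O ρ₁ r
owned-in-view {r = r} V o ¬¬o₁ with O⊆O₁∪O₂ V r o
... | inj₁ o₁ = o₁
... | inj₂ o₂ = ⊥-elim (¬¬o₁ λ o₁ → O₁#O₂ V r o₁ o₂)

view-∪O : ∀ {O₂ ρ ρ₁ r} → View O₂ ρ ρ₁ → ¬ O₂ r →
  View O₂ ⟨ O ρ ∪ᵣ ⁅ r ⁆ , L ρ , D ρ ⟩ ⟨ O ρ₁ ∪ᵣ ⁅ r ⁆ , L ρ₁ , D ρ₁ ⟩
view-∪O V ¬o₂ = record
  { O⊆O₁∪O₂ = λ { x (inj₁ o) → ⊎.map₁ inj₁ (O⊆O₁∪O₂ V x o) ; x (inj₂ e) → inj₁ (inj₂ e) }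
  ; O₁⊆O    = λ x → ⊎.map₁ (O₁⊆O V x)
  ; O₂⊆O    = λ x → inj₁ ∘ O₂⊆O V x
  ; L₁⊆L∪O₂ = L₁⊆L∪O₂ V ; L⊆L₁ = L⊆L₁ V ; O₂⊆L₁ = O₂⊆L₁ V
  ; D⊆D₁    = D⊆D₁ V ; D₁⊆D = D₁⊆D V
  ; O₁#O₂   = λ { x (inj₁ o) o₂ → O₁#O₂ V x o o₂ ; x (inj₂ refl) o₂ → ¬o₂ o₂ } }

view-∪D : ∀ {O₂ ρ ρ₁ r} → View O₂ ρ ρ₁ →
  View O₂ ⟨ O ρ , L ρ , D ρ ∪ᵣ ⁅ r ⁆ ⟩ ⟨ O ρ₁ , L ρ₁ , D ρ₁ ∪ᵣ ⁅ r ⁆ ⟩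
view-∪D V = record
  { O⊆O₁∪O₂ = O⊆O₁∪O₂ V ; O₁⊆O = O₁⊆O V ; O₂⊆O = O₂⊆O V
  ; L₁⊆L∪O₂ = L₁⊆L∪O₂ V ; L⊆L₁ = L⊆L₁ V ; O₂⊆L₁ = O₂⊆L₁ V
  ; D⊆D₁    = λ x → ⊎.map₁ (D⊆D₁ V x)
  ; D₁⊆D    = λ x → ⊎.map₁ (D₁⊆D V x)
  ; O₁#O₂   = O₁#O₂ V }

view-∖O : ∀ {O₂ ρ ρ₁ r} → View O₂ ρ ρ₁ → ¬ O₂ r →
  View O₂ ⟨ O ρ ∖ᵣ r , L ρ , D ρ ⟩ ⟨ O ρ₁ ∖ᵣ r , L ρ₁ , D ρ₁ ⟩
view-∖O V ¬o₂ = record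
  { O⊆O₁∪O₂ = λ { x (o , x≢r) → ⊎.map₁ (_, x≢r) (O⊆O₁∪O₂ V x o) }
  ; O₁⊆O    = λ { x (o , x≢r) → O₁⊆O V x o , x≢r }
  ; O₂⊆O    = λ x o₂ → O₂⊆O V x o₂ , λ { refl → ¬o₂ o₂ }
  ; L₁⊆L∪O₂ = L₁⊆L∪O₂ V ; L⊆L₁ = L⊆L₁ V ; O₂⊆L₁ = O₂⊆L₁ V
  ; D⊆D₁    = D⊆D₁ V ; D₁⊆D = D₁⊆D V
  ; O₁#O₂   = λ { x (o , _) → O₁#O₂ V x o } }

view-∖D : ∀ {O₂ ρ ρ₁ r} → View O₂ ρ ρ₁ →
  View O₂ ⟨ O ρ , L ρ , D ρ ∖ᵣ r ⟩ ⟨ O ρ₁ , L ρ₁ , D ρ₁ ∖ᵣ r ⟩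
view-∖D V = record
  { O⊆O₁∪O₂ = O⊆O₁∪O₂ V ; O₁⊆O = O₁⊆O V ; O₂⊆O = O₂⊆O V
  ; L₁⊆L∪O₂ = L₁⊆L∪O₂ V ; L⊆L₁ = L⊆L₁ V ; O₂⊆L₁ = O₂⊆L₁ V
  ; D⊆D₁    = λ { x (d , x≢r) → D⊆D₁ V x d , x≢r }
  ; D₁⊆D    = λ { x (d , x≢r) → D₁⊆D V x d , x≢r }
  ; O₁#O₂   = O₁#O₂ V }

view-∖ρ : ∀ {O₂ ρ ρ₁ r} → View O₂ ρ ρ₁ → ¬ O₂ r → View O₂ (ρ ∖ρ r) (ρ₁ ∖ρ r)
view-∖ρ V ¬o₂ = record
  { O⊆O₁∪O₂ = O⊆O₁∪O₂ W ; O₁⊆O = O₁⊆O W ; O₂⊆O = O₂⊆O W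
  ; L₁⊆L∪O₂ = λ { x (l , x≢r) → ⊎.map₁ (_, x≢r) (L₁⊆L∪O₂ V x l) }
  ; L⊆L₁    = λ { x (l , x≢r) → L⊆L₁ V x l , x≢r }
  ; O₂⊆L₁   = λ x o₂ → O₂⊆L₁ V x o₂ , λ { refl → ¬o₂ o₂ }
  ; D⊆D₁    = D⊆D₁ W ; D₁⊆D = D₁⊆D W
  ; O₁#O₂   = O₁#O₂ W }
  where W = view-∖D (view-∖O V ¬o₂)

view-∖ρ-both : ∀ {O₂ ρ ρ₁ r} → View O₂ ρ ρ₁ → View (O₂ ∖ᵣ r) (ρ ∖ρ r) (ρ₁ ∖ρ r)
view-∖ρ-both V = record
  { O⊆O₁∪O₂ = λ { x (o , x≢r) → ⊎.map (_, x≢r) (_, x≢r) (O⊆O₁∪O₂ V x o) }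
  ; O₁⊆O    = λ { x (o , x≢r) → O₁⊆O V x o , x≢r }
  ; O₂⊆O    = λ { x (o , x≢r) → O₂⊆O V x o , x≢r }
  ; L₁⊆L∪O₂ = λ { x (l , x≢r) → ⊎.map (_, x≢r) (_, x≢r) (L₁⊆L∪O₂ V x l) }
  ; L⊆L₁    = λ { x (l , x≢r) → L⊆L₁ V x l , x≢r }
  ; O₂⊆L₁   = λ { x (o , x≢r) → O₂⊆L₁ V x o , x≢r }
  ; D⊆D₁    = λ { x (d , x≢r) → D⊆D₁ V x d , x≢r }
  ; D₁⊆D    = λ { x (d , x≢r) → D₁⊆D V x d , x≢r }
  ; O₁#O₂   = λ { x (o , _) (o₂ , _) → O₁#O₂ V x o o₂ } }

-- A view with no sibling is an equivalence of configurations.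
view-release : ∀ {ρ r} → ¬ L ρ r → ¬ D ρ r → View ∅ᵣ ⟨ O ρ ∖ᵣ r , L ρ , D ρ ⟩ (ρ ∖ρ r)
view-release {ρ} ¬l ¬d = record
  { O⊆O₁∪O₂ = λ _ → inj₁
  ; O₁⊆O    = λ _ o → o
  ; O₂⊆O    = λ _ ()
  ; L₁⊆L∪O₂ = λ _ → inj₁ ∘ proj₁
  ; L⊆L₁    = λ _ l → l , λ { refl → ¬l l }
  ; O₂⊆L₁   = λ _ ()
  ; D⊆D₁    = λ _ d → d , λ { refl → ¬d d }
  ; D₁⊆D    = λ _ → proj₁
  ; O₁#O₂   = λ _ _ () }

IsRConf-∪O : ∀ {ρ r} → IsRConf ρ → ¬ r ∈ρ ρ → IsRConf ⟨ O ρ ∪ᵣ ⁅ r ⁆ , L ρ , D ρ ⟩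
IsRConf-∪O (OL , OD , LD) r∉ =
  (λ { x (inj₁ o) l → OL x o l ; x (inj₂ refl) l → r∉ (inj₂ (inj₁ l)) }) ,
  (λ { x (inj₁ o) d → OD x o d ; x (inj₂ refl) d → r∉ (inj₂ (inj₂ d)) }) , LD

IsRConf-∪D : ∀ {ρ r} → IsRConf ρ → ¬ r ∈ρ ρ → IsRConf ⟨ O ρ , L ρ , D ρ ∪ᵣ ⁅ r ⁆ ⟩
IsRConf-∪D (OL , OD , LD) r∉ =
  OL ,
  (λ { x o (inj₁ d) → OD x o d ; x o (inj₂ refl) → r∉ (inj₁ o) }) ,
  (λ { x l (inj₁ d) → LD x l d ; x l (inj₂ refl) → r∉ (inj₂ (inj₁ l)) })

IsRConf-∖O : ∀ {ρ r} → IsRConf ρ → IsRConf ⟨ O ρ ∖ᵣ r , L ρ , D ρ ⟩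
IsRConf-∖O (OL , OD , LD) = (λ x → OL x ∘ proj₁) , (λ x → OD x ∘ proj₁) , LD

-- Frame property of program steps

basic-abort-mono : ∀ {c s X Y} → BasicAbort c s X → Y ⊑ X → BasicAbort c s Y
basic-abort-mono (ba-lookup e)  sub = ba-lookup  (⊑-respects-nothing sub _ e)
basic-abort-mono (ba-mutate e)  sub = ba-mutate  (⊑-respects-nothing sub _ e)
basic-abort-mono (ba-dispose e) sub = ba-dispose (⊑-respects-nothing sub _ e)

abort-restrict : ∀ {C s X ρ O₂ ρ₁ Y} → C , s , X , ρ ⟶abort → View O₂ ρ ρ₁ → Y ⊑ X →
  C , s , Y , ρ₁ ⟶abort
abort-restrict (RA r∈)  V sub = RA (∈-view V r∈)
abort-restrict (WA r∉)  V sub = WA (r∉ ∘ ∈-unview V)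
abort-restrict (RA1 r∉ lk a) V sub =
  RA1 (r∉ ∘ ∈-unview V) lk (abort-restrict a (view-∪O V (r∉ ∘ inj₁ ∘ O₂⊆O V _)) sub)
abort-restrict (RA2 r∉ lk a) V sub = RA2 (r∉ ∘ ∈-unview V) lk (abort-restrict a (view-∪D V) sub)
abort-restrict (BCA b)  V sub = BCA (basic-abort-mono b sub)
abort-restrict (SA a)   V sub = SA (abort-restrict a V sub)
abort-restrict (WA1 a)  V sub = WA1 (abort-restrict a (view-∖ρ-both V) sub)
abort-restrict (WA2 ¬o) V sub = WA2 (¬o ∘ O₁⊆O V _)
abort-restrict (PA1 a)  V sub = PA1 (abort-restrict a V sub)
abort-restrict (PA2 a)  V sub = PA2 (abort-restrict a V sub)

FramedStep : Cmd → Store → Heap → RConf → Cmd → Store → Heap → RConf → Heap → RSet → Set₁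
FramedStep C s Y ρ₁ C' s' X' ρ' Z O₂ =
  Σ Heap λ Y' → Σ RConf λ ρ₁' →
    (C , s , Y , ρ₁ ⟶ₚ C' , s' , Y' , ρ₁') × X' ≈ Y' ∪ₕ Z × Y' # Z × View O₂ ρ' ρ₁'

step-frame : ∀ {C s X ρ C' s' X' ρ' O₂ ρ₁ Y Z Y₀} → C , s , X , ρ ⟶ₚ C' , s' , X' , ρ' →
  View O₂ ρ ρ₁ → IsRConf ρ₁ → X ≈ Y ∪ₕ Z → Y # Z → Y₀ ⊑ Y → ¬ (C , s , Y₀ , ρ₁ ⟶abort) →
  FramedStep C s Y ρ₁ C' s' X' ρ' Z O₂
step-frame S1      V wf p d sub safe = _ , _ , S1 , p , d , V
step-frame LP      V wf p d sub safe = _ , _ , LP , p , d , V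
step-frame (IF1 b) V wf p d sub safe = _ , _ , IF1 b , p , d , V
step-frame (IF2 b) V wf p d sub safe = _ , _ , IF2 b , p , d , V
step-frame P3      V wf p d sub safe = _ , _ , P3 , p , d , V
step-frame (R0 r∉) V wf p d sub safe = _ , _ , R0 (r∉ ∘ ∈-unview V) , p , d , V
step-frame (S2 st) V wf p d sub safe =
  let _ , _ , st' , rest = step-frame st V wf p d sub (safe ∘ SA) in _ , _ , S2 st' , rest
step-frame (P1 st) V wf p d sub safe =
  let _ , _ , st' , rest = step-frame st V wf p d sub (safe ∘ PA1) in _ , _ , P1 st' , rest
step-frame (P2 st) V wf p d sub safe =
  let _ , _ , st' , rest = step-frame st V wf p d sub (safe ∘ PA2) in _ , _ , P2 st' , rest
step-frame (R1 r∉ lk st) V wf p d sub safe =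
  let r∉₁ = r∉ ∘ ∈-unview V
      ¬o₂ = r∉ ∘ inj₁ ∘ O₂⊆O V _
      _ , _ , st' , p' , d' , V' =
        step-frame st (view-∪O V ¬o₂) (IsRConf-∪O wf r∉₁) p d sub (safe ∘ RA1 r∉₁ lk)
  in _ , _ , R1 r∉₁ lk st' , p' , d' , view-∖ρ V' ¬o₂
step-frame (R2 r∉ lk st) V wf p d sub safe =
  let r∉₁ = r∉ ∘ ∈-unview V
      _ , _ , st' , p' , d' , V' =
        step-frame st (view-∪D V) (IsRConf-∪D wf r∉₁) p d sub (safe ∘ RA2 r∉₁ lk)
  in _ , _ , R2 r∉₁ lk st' , p' , d' , view-∖ρ V' (r∉ ∘ inj₁ ∘ O₂⊆O V _)
step-frame (W0 d∈ b) V wf@(_ , _ , LD) p d sub safe =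
  _ , _ , W0 (D⊆D₁ V _ d∈) b , p , d ,
  view-∖D (view-∪O V λ o₂ → LD _ (O₂⊆L₁ V _ o₂) (D⊆D₁ V _ d∈))
step-frame (W1 o st) V wf@(OL , OD , _) p d sub safe =
  let o₁  = owned-in-view V o (safe ∘ WA2)
      ¬o₂ = O₁#O₂ V _ o₁
      released = view-release (OL _ o₁) (OD _ o₁)
      _ , _ , st' , p' , d' , V' =
        step-frame st (view-∖O V ¬o₂) (IsRConf-∖O wf) p d sub
          (λ a → safe (WA1 (abort-restrict a released ⊑-refl)))
  in _ , _ , W1 o₁ st' , p' , d' , view-∪O V' ¬o₂
step-frame (W2 o) V wf p d sub safe =
  let o₁ = owned-in-view V o (safe ∘ WA2)
  in _ , _ , W2 o₁ , p , d , view-∪D (view-∖O V (O₁#O₂ V _ o₁))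
step-frame (BCT b) V wf p d sub safe =
  let _ , b' , p' , d' = basic-frame b p d sub (safe ∘ BCA) in _ , _ , BCT b' , p' , d' , V

≃ᵣ-refl : ∀ {X} → X ≃ᵣ X
≃ᵣ-refl _ = ⇔.refl

∉-singleton : ∀ {X : RSet} {r x} → X x → ¬ X r → x ≢ r
∉-singleton x∈ r∉ refl = r∉ x∈

close-scope : ∀ {O D Z : RSet} {r} → (∀ x → (O ∪ᵣ D) x → Z x ⊎ x ≡ r) → (∀ x → Z x → (O ∪ᵣ D) x) →
  ¬ Z r → ((O ∖ᵣ r) ∪ᵣ (D ∖ᵣ r)) ≃ᵣ Z
close-scope to′ from′ r∉ x = mk⇔
  (λ { (inj₁ (o , x≢r)) → ⊎.[ id , ⊥-elim ∘ x≢r ] (to′ x (inj₁ o))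
     ; (inj₂ (d , x≢r)) → ⊎.[ id , ⊥-elim ∘ x≢r ] (to′ x (inj₂ d)) })
  (λ z → ⊎.map (_, ∉-singleton z r∉) (_, ∉-singleton z r∉) (from′ x z))

step-preserves-L : ∀ {C s X ρ C' s' X' ρ'} → C , s , X , ρ ⟶ₚ C' , s' , X' , ρ' → L ρ' ≃ᵣ L ρ
step-preserves-L (S2 st)       = step-preserves-L st
step-preserves-L (P1 st)       = step-preserves-L st
step-preserves-L (P2 st)       = step-preserves-L st
step-preserves-L (R1 r∉ _ st)  x = mk⇔ (to (step-preserves-L st x) ∘ proj₁)
  (λ l → from (step-preserves-L st x) l , ∉-singleton l (r∉ ∘ inj₂ ∘ inj₁))
step-preserves-L (R2 r∉ _ st)  x = mk⇔ (to (step-preserves-L st x) ∘ proj₁)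
  (λ l → from (step-preserves-L st x) l , ∉-singleton l (r∉ ∘ inj₂ ∘ inj₁))
step-preserves-L (W1 _ st)     = step-preserves-L st
step-preserves-L S1            = ≃ᵣ-refl
step-preserves-L LP            = ≃ᵣ-refl
step-preserves-L (IF1 _)       = ≃ᵣ-refl
step-preserves-L (IF2 _)       = ≃ᵣ-refl
step-preserves-L P3            = ≃ᵣ-refl
step-preserves-L (R0 _)        = ≃ᵣ-refl
step-preserves-L (W0 _ _)      = ≃ᵣ-refl
step-preserves-L (W2 _)        = ≃ᵣ-refl
step-preserves-L (BCT _)       = ≃ᵣ-refl

close-owned-scope : ∀ {O D O'' D'' : RSet} {r} → (O'' ∪ᵣ D'') ≃ᵣ ((O ∪ᵣ ⁅ r ⁆) ∪ᵣ D) →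
  ¬ (O ∪ᵣ D) r →
  ((O'' ∖ᵣ r) ∪ᵣ (D'' ∖ᵣ r)) ≃ᵣ (O ∪ᵣ D)
close-owned-scope {O} {D} {r = r} IH =
  close-scope (λ x → split ∘ to (IH x)) (λ x → from (IH x) ∘ ⊎.map₁ inj₁)
  where
  split : ∀ {x} → ((O ∪ᵣ ⁅ r ⁆) ∪ᵣ D) x → (O ∪ᵣ D) x ⊎ x ≡ r
  split (inj₁ (inj₁ o)) = inj₁ (inj₁ o)
  split (inj₁ (inj₂ e)) = inj₂ e
  split (inj₂ d)        = inj₁ (inj₂ d)

close-available-scope : ∀ {O D O'' D'' : RSet} {r} → (O'' ∪ᵣ D'') ≃ᵣ (O ∪ᵣ (D ∪ᵣ ⁅ r ⁆)) →
  ¬ (O ∪ᵣ D) r →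
  ((O'' ∖ᵣ r) ∪ᵣ (D'' ∖ᵣ r)) ≃ᵣ (O ∪ᵣ D)
close-available-scope {O} {D} {r = r} IH =
  close-scope (λ x → split ∘ to (IH x)) (λ x → from (IH x) ∘ ⊎.map₂ inj₁)
  where
  split : ∀ {x} → (O ∪ᵣ (D ∪ᵣ ⁅ r ⁆)) x → (O ∪ᵣ D) x ⊎ x ≡ r
  split (inj₁ o)        = inj₁ (inj₁ o)
  split (inj₂ (inj₁ d)) = inj₁ (inj₂ d)
  split (inj₂ (inj₂ e)) = inj₂ e

acquire-O∪D : ∀ {O D : RSet} {r} → D r → ((O ∪ᵣ ⁅ r ⁆) ∪ᵣ (D ∖ᵣ r)) ≃ᵣ (O ∪ᵣ D)
acquire-O∪D {O} {D} {r} d∈ x = mk⇔ to′ from′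
  where
  to′ : ((O ∪ᵣ ⁅ r ⁆) ∪ᵣ (D ∖ᵣ r)) x → (O ∪ᵣ D) x
  to′ (inj₁ (inj₁ o))    = inj₁ o
  to′ (inj₁ (inj₂ refl)) = inj₂ d∈
  to′ (inj₂ (d , _))     = inj₂ d
  from′ : (O ∪ᵣ D) x → ((O ∪ᵣ ⁅ r ⁆) ∪ᵣ (D ∖ᵣ r)) x
  from′ (inj₁ o) = inj₁ (inj₁ o)
  from′ (inj₂ d) with x ℕ.≟ r
  ... | yes x≡r = inj₁ (inj₂ x≡r)
  ... | no  x≢r = inj₂ (d , x≢r)

release-O∪D : ∀ {O D : RSet} {r} → O r → ((O ∖ᵣ r) ∪ᵣ (D ∪ᵣ ⁅ r ⁆)) ≃ᵣ (O ∪ᵣ D)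
release-O∪D {O} {D} {r} o∈ x = mk⇔ to′ from′
  where
  to′ : ((O ∖ᵣ r) ∪ᵣ (D ∪ᵣ ⁅ r ⁆)) x → (O ∪ᵣ D) x
  to′ (inj₁ (o , _))     = inj₁ o
  to′ (inj₂ (inj₁ d))    = inj₂ d
  to′ (inj₂ (inj₂ refl)) = inj₁ o∈
  from′ : (O ∪ᵣ D) x → ((O ∖ᵣ r) ∪ᵣ (D ∪ᵣ ⁅ r ⁆)) x
  from′ (inj₂ d) = inj₂ (inj₁ d)
  from′ (inj₁ o) with x ℕ.≟ r
  ... | yes x≡r = inj₂ (inj₂ x≡r)
  ... | no  x≢r = inj₁ (o , x≢r)

reacquire-O∪D : ∀ {O D O' D' : RSet} {r} → O r → (O' ∪ᵣ D') ≃ᵣ ((O ∖ᵣ r) ∪ᵣ D) →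
  ((O' ∪ᵣ ⁅ r ⁆) ∪ᵣ D') ≃ᵣ (O ∪ᵣ D)
reacquire-O∪D {O} {D} {O'} {D'} {r} o∈ IH x = mk⇔ to′ from′
  where
  to′ : ((O' ∪ᵣ ⁅ r ⁆) ∪ᵣ D') x → (O ∪ᵣ D) x
  to′ (inj₁ (inj₁ o))    = ⊎.map₁ proj₁ (to (IH x) (inj₁ o))
  to′ (inj₁ (inj₂ refl)) = inj₁ o∈
  to′ (inj₂ d)           = ⊎.map₁ proj₁ (to (IH x) (inj₂ d))
  from′ : (O ∪ᵣ D) x → ((O' ∪ᵣ ⁅ r ⁆) ∪ᵣ D') x
  from′ od with x ℕ.≟ r
  ... | yes x≡r = inj₁ (inj₂ x≡r)
  ... | no  x≢r = ⊎.map₁ inj₁ (from (IH x) (⊎.map₁ (_, x≢r) od))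

step-preserves-O∪D : ∀ {C s X ρ C' s' X' ρ'} → C , s , X , ρ ⟶ₚ C' , s' , X' , ρ' →
  (O ρ' ∪ᵣ D ρ') ≃ᵣ (O ρ ∪ᵣ D ρ)
step-preserves-O∪D (S2 st)      = step-preserves-O∪D st
step-preserves-O∪D (P1 st)      = step-preserves-O∪D st
step-preserves-O∪D (P2 st)      = step-preserves-O∪D st
step-preserves-O∪D (R1 r∉ _ st) = close-owned-scope (step-preserves-O∪D st) (r∉ ∘ ⊎.map₂ inj₂)
step-preserves-O∪D (R2 r∉ _ st) = close-available-scope (step-preserves-O∪D st) (r∉ ∘ ⊎.map₂ inj₂)
step-preserves-O∪D (W0 d∈ _)    = acquire-O∪D d∈
step-preserves-O∪D (W1 o∈ st)   = reacquire-O∪D o∈ (step-preserves-O∪D st)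
step-preserves-O∪D (W2 o∈)      = release-O∪D o∈
step-preserves-O∪D S1           = ≃ᵣ-refl
step-preserves-O∪D LP              = ≃ᵣ-refl
step-preserves-O∪D (IF1 _)         = ≃ᵣ-refl
step-preserves-O∪D (IF2 _)         = ≃ᵣ-refl
step-preserves-O∪D P3              = ≃ᵣ-refl
step-preserves-O∪D (R0 _)          = ≃ᵣ-refl
step-preserves-O∪D (BCT _)         = ≃ᵣ-refl

IsRConf-∖ρ : ∀ {ρ r} → IsRConf ρ → IsRConf (ρ ∖ρ r)
IsRConf-∖ρ (OL , OD , LD) =
  (λ x o l → OL x (proj₁ o) (proj₁ l)) ,
  (λ x o d → OD x (proj₁ o) (proj₁ d)) ,
  (λ x l d → LD x (proj₁ l) (proj₁ d))

step-preserves-IsRConf : ∀ {C s X ρ C' s' X' ρ'} → C , s , X , ρ ⟶ₚ C' , s' , X' , ρ' →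
  IsRConf ρ → IsRConf ρ'
step-preserves-IsRConf (S2 st) = step-preserves-IsRConf st
step-preserves-IsRConf (P1 st) = step-preserves-IsRConf st
step-preserves-IsRConf (P2 st) = step-preserves-IsRConf st
step-preserves-IsRConf (R1 r∉ _ st) wf = IsRConf-∖ρ (step-preserves-IsRConf st (IsRConf-∪O wf r∉))
step-preserves-IsRConf (R2 r∉ _ st) wf = IsRConf-∖ρ (step-preserves-IsRConf st (IsRConf-∪D wf r∉))
step-preserves-IsRConf (W0 d∈ _) (OL , OD , LD) =
  (λ { x (inj₁ o) l → OL x o l ; x (inj₂ refl) l → LD x l d∈ }) ,
  (λ { x (inj₁ o) (d , _) → OD x o d ; x (inj₂ refl) (_ , x≢x) → x≢x refl }) ,
  (λ x l d → LD x l (proj₁ d))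
step-preserves-IsRConf (W1 {r = r} {O = O} {D = D} o∈ st) wf@(OL , OD , _) =
  IsRConf-∪O (step-preserves-IsRConf st (IsRConf-∖O wf)) λ where
    (inj₁ o)        → unowned (to (step-preserves-O∪D st r) (inj₁ o))
    (inj₂ (inj₁ l)) → OL r o∈ (to (step-preserves-L st r) l)
    (inj₂ (inj₂ d)) → unowned (to (step-preserves-O∪D st r) (inj₂ d))
  where
  unowned : ((O ∖ᵣ r) ∪ᵣ D) r → ⊥
  unowned (inj₁ (_ , r≢r)) = r≢r refl
  unowned (inj₂ d)         = OD r o∈ d
step-preserves-IsRConf (W2 o∈) (OL , OD , LD) =
  (λ x o l → OL x (proj₁ o) l) ,
  (λ { x (o , _) (inj₁ d) → OD x o d ; x (_ , x≢r) (inj₂ x≡r) → x≢r x≡r }) ,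
  (λ { x l (inj₁ d) → LD x l d ; x l (inj₂ refl) → OL x o∈ l })
step-preserves-IsRConf S1      wf = wf
step-preserves-IsRConf LP      wf = wf
step-preserves-IsRConf (IF1 _) wf = wf
step-preserves-IsRConf (IF2 _) wf = wf
step-preserves-IsRConf P3      wf = wf
step-preserves-IsRConf (R0 _)  wf = wf
step-preserves-IsRConf (BCT _) wf = wf

[↦]-≢ : ∀ (s : Store) {x y} v → x ≢ y → (s [ y ↦ v ]) x ≡ s x
[↦]-≢ s {x} {y} v x≢y = cong (if_then v else s x) (dec-false (x ℕ.≟ y) x≢y)

[↦]-≡ : ∀ (s : Store) {x} v → (s [ x ↦ v ]) x ≡ v
[↦]-≡ s {x} v = cong (if_then v else s x) (dec-true (x ℕ.≟ x) refl)

basic-step-preserves : ∀ {c s h s' h'} → BasicStep c s h s' h' → ∀ x → ¬ modBasic c x → s x ≡ s' x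
basic-step-preserves (bs-assign {s = s})   x ¬m = sym ([↦]-≢ s _ ¬m)
basic-step-preserves (bs-lookup {s = s} _) x ¬m = sym ([↦]-≢ s _ ¬m)
basic-step-preserves (bs-cons {s = s} _ _) x ¬m = sym ([↦]-≢ s _ ¬m)
basic-step-preserves (bs-mutate _)         x ¬m = refl
basic-step-preserves (bs-dispose _)        x ¬m = refl

step-preserves-var : ∀ {C s X ρ C' s' X' ρ'} → C , s , X , ρ ⟶ₚ C' , s' , X' , ρ' →
  ∀ x → ¬ chng C x → s x ≡ s' x
step-preserves-var (S2 st)      x ¬c = step-preserves-var st x ¬c
step-preserves-var (P1 st)      x ¬c = step-preserves-var st x (¬c ∘ inj₁)
step-preserves-var (P2 st)      x ¬c = step-preserves-var st x (¬c ∘ inj₂)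
step-preserves-var (R1 _ _ st)  x ¬c = step-preserves-var st x ¬c
step-preserves-var (R2 _ _ st)  x ¬c = step-preserves-var st x ¬c
step-preserves-var (W1 _ st)    x ¬c = step-preserves-var st x ¬c
step-preserves-var (BCT b)      x ¬c = basic-step-preserves b x ¬c
step-preserves-var S1           x ¬c = refl
step-preserves-var LP           x ¬c = refl
step-preserves-var (IF1 _)      x ¬c = refl
step-preserves-var (IF2 _)      x ¬c = refl
step-preserves-var P3           x ¬c = refl
step-preserves-var (R0 _)       x ¬c = refl
step-preserves-var (W0 _ _)     x ¬c = refl
step-preserves-var (W2 _)       x ¬c = refl

chng⊆mod : ∀ C x → chng C x → mod C x
chng⊆mod (basic c)              x m        = m
chng⊆mod (C₁ ⨾ C₂)              x m        = inj₁ (chng⊆mod C₁ x m)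
chng⊆mod (C₁ ∥ C₂)              x (inj₁ m) = inj₁ (chng⊆mod C₁ x m)
chng⊆mod (C₁ ∥ C₂)              x (inj₂ m) = inj₂ (chng⊆mod C₂ x m)
chng⊆mod (resource _ inside C)  x m        = chng⊆mod C x m
chng⊆mod (within _ exec C)      x m        = chng⊆mod C x m

step-mod-mono : ∀ {C s X ρ C' s' X' ρ'} → C , s , X , ρ ⟶ₚ C' , s' , X' , ρ' →
  ∀ x → mod C' x → mod C x
step-mod-mono S1          x m               = inj₂ m
step-mod-mono (S2 st)     x (inj₁ m)        = inj₁ (step-mod-mono st x m)
step-mod-mono (S2 st)     x (inj₂ m)        = inj₂ m
step-mod-mono LP          x (inj₁ (inj₁ m)) = m
step-mod-mono LP          x (inj₁ (inj₂ m)) = m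
step-mod-mono (IF1 _)     x m               = inj₁ m
step-mod-mono (IF2 _)     x m               = inj₂ m
step-mod-mono (P1 st)     x (inj₁ m)        = inj₁ (step-mod-mono st x m)
step-mod-mono (P1 st)     x (inj₂ m)        = inj₂ m
step-mod-mono (P2 st)     x (inj₁ m)        = inj₁ m
step-mod-mono (P2 st)     x (inj₂ m)        = inj₂ (step-mod-mono st x m)
step-mod-mono (R1 _ _ st) x m               = step-mod-mono st x m
step-mod-mono (R2 _ _ st) x m               = step-mod-mono st x m
step-mod-mono (W0 _ _)    x m               = m
step-mod-mono (W1 _ st)   x m               = step-mod-mono st x m

locked-owned : ∀ C {s h ρ r} → ¬ (C , s , h , ρ ⟶abort) → Locked C r → ¬ ¬ O ρ r
locked-owned (C₁ ⨾ C₂) safe lk = locked-owned C₁ (safe ∘ SA) lk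
locked-owned (C₁ ∥ C₂) safe (inj₁ lk) = locked-owned C₁ (safe ∘ PA1) lk
locked-owned (C₁ ∥ C₂) safe (inj₂ lk) = locked-owned C₂ (safe ∘ PA2) lk
-- Which of R1/R2 applies depends on Locked C r', decided classically: the goal is negative.
locked-owned (resource r' inside C) safe (lk , r≢r') ¬o = ¬¬-excluded-middle λ where
  (yes lk') → locked-owned C (safe ∘ RA1 (safe ∘ RA) lk') lk ⊎.[ ¬o , r≢r' ]
  (no ¬lk') → locked-owned C (safe ∘ RA2 (safe ∘ RA) ¬lk') lk ¬o
locked-owned (within r' exec C) safe (inj₁ lk)   ¬o = locked-owned C (safe ∘ WA1) lk (¬o ∘ proj₁)
locked-owned (within r' exec C) safe (inj₂ refl) ¬o = safe (WA2 ¬o)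

-- Assertions depend only on their free variables

agreeˡ : ∀ {A B s s'} → AgreeOn (A ∪ᵥ B) s s' → AgreeOn A s s'
agreeˡ ag x = ag x ∘ inj₁

agreeʳ : ∀ {A B s s'} → AgreeOn (A ∪ᵥ B) s s' → AgreeOn B s s'
agreeʳ ag x = ag x ∘ inj₂

agree-sym : ∀ {A s s'} → AgreeOn A s s' → AgreeOn A s' s
agree-sym ag x a = sym (ag x a)

⟦⟧ₑ-agree : ∀ e {s s'} → AgreeOn (FVₑ e) s s' → ⟦ e ⟧ₑ s ≡ ⟦ e ⟧ₑ s'
⟦⟧ₑ-agree (var y)  ag = ag y refl
⟦⟧ₑ-agree (lit _)  ag = refl
⟦⟧ₑ-agree (e ⊕ e') ag = cong₂ ℤ._+_ (⟦⟧ₑ-agree e (agreeˡ ag)) (⟦⟧ₑ-agree e' (agreeʳ ag))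
⟦⟧ₑ-agree (e ⊖ e') ag = cong₂ ℤ._-_ (⟦⟧ₑ-agree e (agreeˡ ag)) (⟦⟧ₑ-agree e' (agreeʳ ag))
⟦⟧ₑ-agree (e ⊗ e') ag = cong₂ ℤ._*_ (⟦⟧ₑ-agree e (agreeˡ ag)) (⟦⟧ₑ-agree e' (agreeʳ ag))

⟦⟧ᵦ-agree : ∀ b {s s'} → AgreeOn (FVᵦ b) s s' → ⟦ b ⟧ᵦ s ≡ ⟦ b ⟧ᵦ s'
⟦⟧ᵦ-agree btrue       ag = refl
⟦⟧ᵦ-agree bfalse      ag = refl
⟦⟧ᵦ-agree (e == e')   ag =
  cong₂ (λ a b → does (a ℤ.≟ b)) (⟦⟧ₑ-agree e (agreeˡ ag)) (⟦⟧ₑ-agree e' (agreeʳ ag))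
⟦⟧ᵦ-agree (e <= e')   ag =
  cong₂ (λ a b → does (a ℤ.≤? b)) (⟦⟧ₑ-agree e (agreeˡ ag)) (⟦⟧ₑ-agree e' (agreeʳ ag))
⟦⟧ᵦ-agree (bnot b)    ag = cong not (⟦⟧ᵦ-agree b ag)
⟦⟧ᵦ-agree (b band b') ag = cong₂ _∧_ (⟦⟧ᵦ-agree b (agreeˡ ag)) (⟦⟧ᵦ-agree b' (agreeʳ ag))
⟦⟧ᵦ-agree (b bor b')  ag = cong₂ _∨_ (⟦⟧ᵦ-agree b (agreeˡ ag)) (⟦⟧ᵦ-agree b' (agreeʳ ag))

agree-[↦] : ∀ {s s' : Store} (P : Assn) x v → AgreeOn (FV (`∃ x P)) s s' →
  AgreeOn (FV P) (s [ x ↦ v ]) (s' [ x ↦ v ])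
agree-[↦] {s} {s'} P x v ag y y∈ with y ℕ.≟ x
... | yes refl = trans ([↦]-≡ s v) (sym ([↦]-≡ s' v))
... | no  y≢x  = trans ([↦]-≢ s v y≢x) (trans (ag y (y∈ , y≢x)) (sym ([↦]-≢ s' v y≢x)))

⊨-cong : ∀ P {s s' h h'} → AgreeOn (FV P) s s' → h ≈ h' → (s , h) ⊨ P → (s' , h') ⊨ P
⊨-cong (`bool b) ag p sat = trans (sym (⟦⟧ᵦ-agree b ag)) sat
⊨-cong `emp ag (mk≈ p) sat l = trans (sym (p l)) (sat l)
⊨-cong (e `↦ e') {h' = h'} ag (mk≈ p) (pt , only) =
  trans (cong (fun h') (sym ⟦e⟧)) (trans (sym (p _)) (trans pt (cong just ⟦e'⟧))) ,
  λ l l≢ → trans (sym (p l)) (only l (l≢ ∘ λ eq → trans eq ⟦e⟧))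
  where
  ⟦e⟧  = ⟦⟧ₑ-agree e (agreeˡ ag)
  ⟦e'⟧ = ⟦⟧ₑ-agree e' (agreeʳ ag)
⊨-cong (P `∗ Q) ag (mk≈ p) (h₁ , h₂ , d , split , sat₁ , sat₂) =
  h₁ , h₂ , d , (λ l → trans (sym (p l)) (split l)) ,
  ⊨-cong P (agreeˡ ag) ≈-refl sat₁ , ⊨-cong Q (agreeʳ ag) ≈-refl sat₂
⊨-cong (P `-∗ Q) {h = h} ag p wand h'' d sat =
  ⊨-cong Q (agreeʳ ag) (∪-cong p (≈-refl {h''}))
    (wand h'' (un# (#-cong (≈-sym p) (≈-refl {h''}) (mk# d)))
      (⊨-cong P (agree-sym (agreeˡ ag)) ≈-refl sat))
⊨-cong (P `∧ Q) ag p (sat₁ , sat₂) = ⊨-cong P (agreeˡ ag) p sat₁ , ⊨-cong Q (agreeʳ ag) p sat₂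
⊨-cong (P `∨ Q) ag p (inj₁ sat) = inj₁ (⊨-cong P (agreeˡ ag) p sat)
⊨-cong (P `∨ Q) ag p (inj₂ sat) = inj₂ (⊨-cong Q (agreeʳ ag) p sat)
⊨-cong (P `⇒ Q) ag p imp sat =
  ⊨-cong Q (agreeʳ ag) p (imp (⊨-cong P (agree-sym (agreeˡ ag)) (≈-sym p) sat))
⊨-cong (`¬ P) ag p ¬sat sat = ¬sat (⊨-cong P (agree-sym ag) (≈-sym p) sat)
⊨-cong (`∃ x P) ag p (v , sat) = v , ⊨-cong P (agree-[↦] P x v ag) p sat
⊨-cong (`∀ x P) ag p sat v = ⊨-cong P (agree-[↦] P x v ag) p (sat v)

⊛sat-resp : ∀ Γ {s h D D'} → (∀ r → D r → D' r) → (∀ r → D' r → D r) → ⊛sat s h Γ D → ⊛sat s h Γ D'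
⊛sat-resp []      D⊆D' D'⊆D sat = sat
⊛sat-resp (_ ∷ Γ) D⊆D' D'⊆D (inj₁ (d , h₁ , h₂ , dj , split , inv , rest)) =
  inj₁ (D⊆D' _ d , h₁ , h₂ , dj , split , inv , ⊛sat-resp Γ D⊆D' D'⊆D rest)
⊛sat-resp (_ ∷ Γ) D⊆D' D'⊆D (inj₂ (¬d , rest)) = inj₂ (¬d ∘ D'⊆D _ , ⊛sat-resp Γ D⊆D' D'⊆D rest)

⊛sat-precise : ∀ Γ {s D X a b} → WFResCtx Γ → a ⊑ X → b ⊑ X → ⊛sat s a Γ D → ⊛sat s b Γ D → a ≈ b
⊛sat-precise [] _ _ _ emp-a emp-b = mk≈ λ l → trans (emp-a l) (sym (emp-b l))
⊛sat-precise (e ∷ Γ) {s} {X = X} {a} {b} (_ , precise , _ , wf) a⊑ b⊑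
  (inj₁ (_ , a₁ , a₂ , da , split-a , inv-a , rest-a))
  (inj₁ (_ , b₁ , b₂ , db , split-b , inv-b , rest-b)) =
  begin
    a           ≈⟨ a≈ ⟩
    a₁ ∪ₕ a₂    ≈⟨ ∪-cong a₁≈b₁ a₂≈b₂ ⟩
    b₁ ∪ₕ b₂    ≈⟨ ≈-sym b≈ ⟩
    b           ∎
  where
  open ≈-Reasoning
  a≈ : a ≈ a₁ ∪ₕ a₂
  a≈ = mk≈ split-a
  b≈ : b ≈ b₁ ∪ₕ b₂
  b≈ = mk≈ split-b
  a₁≈b₁ = mk≈ (precise s X a₁ b₁ (un⊑ (⊑-trans (partˡ a≈) a⊑)) (un⊑ (⊑-trans (partˡ b≈) b⊑))
                 inv-a inv-b)
  a₂≈b₂ = ⊛sat-precise Γ wf (⊑-trans (partʳ (mk# da) a≈) a⊑) (⊑-trans (partʳ (mk# db) b≈) b⊑)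
            rest-a rest-b
⊛sat-precise (_ ∷ _) _ _ _ (inj₁ (d , _)) (inj₂ (¬d , _)) = ⊥-elim (¬d d)
⊛sat-precise (_ ∷ _) _ _ _ (inj₂ (¬d , _)) (inj₁ (d , _)) = ⊥-elim (¬d d)
⊛sat-precise (_ ∷ Γ) (_ , _ , _ , wf) a⊑ b⊑ (inj₂ (_ , rest-a)) (inj₂ (_ , rest-b)) =
  ⊛sat-precise Γ wf a⊑ b⊑ rest-a rest-b

-- By precision, the shared part of a heap is determined, hence so is the local part.
⊛sat-cancel : ∀ Γ {s D h hG h' hG'} → WFResCtx Γ → h ∪ₕ hG ≈ h' ∪ₕ hG' → h # hG → h' # hG' →
  ⊛sat s hG Γ D → ⊛sat s hG' Γ D → h ≈ h'
⊛sat-cancel Γ wf p d d' sat sat' =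
  ∪-cancelʳ p d d' (⊛sat-precise Γ wf (⊑-∪ʳ d) (⊑-trans (⊑-∪ʳ d') (≈⇒⊑ (≈-sym p))) sat sat')

thread-view : ∀ {ρ O₁ O₂} → (∀ r → O ρ r → O₁ r ⊎ O₂ r) → (∀ r → O₁ r → O ρ r) →
  (∀ r → O₂ r → O ρ r) → DisjointRS O₁ O₂ → View O₂ ρ ⟨ O₁ , L ρ ∪ᵣ O₂ , D ρ ⟩
thread-view O⊆ O₁⊆ O₂⊆ O₁#O₂ = record
  { O⊆O₁∪O₂ = O⊆ ; O₁⊆O = O₁⊆ ; O₂⊆O = O₂⊆
  ; L₁⊆L∪O₂ = λ _ l → l ; L⊆L₁ = λ _ → inj₁ ; O₂⊆L₁ = λ _ → inj₂
  ; D⊆D₁ = λ _ d → d ; D₁⊆D = λ _ d → d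
  ; O₁#O₂ = O₁#O₂ }

sibling-view : ∀ {O₂ ρ ρ₁} → View O₂ ρ ρ₁ → View (O ρ₁) ρ ⟨ O₂ , L ρ ∪ᵣ O ρ₁ , D ρ ⟩
sibling-view V = thread-view (λ r → ⊎.swap ∘ O⊆O₁∪O₂ V r) (O₂⊆O V) (O₁⊆O V) (λ r → flip (O₁#O₂ V r))

env-view : ∀ {O₂ ρ ρ₁ L' D'} → View O₂ ρ ρ₁ → View O₂ ⟨ O ρ , L' , D' ⟩ ⟨ O ρ₁ , L' ∪ᵣ O₂ , D' ⟩
env-view V = thread-view (O⊆O₁∪O₂ V) (O₁⊆O V) (O₂⊆O V) (O₁#O₂ V)

view-IsRConf : ∀ {O₂ ρ ρ₁} → View O₂ ρ ρ₁ → IsRConf ρ → IsRConf ρ₁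
view-IsRConf V (OL , OD , LD) =
  (λ r o₁ l₁ → ⊎.[ OL r (O₁⊆O V r o₁) , O₁#O₂ V r o₁ ] (L₁⊆L∪O₂ V r l₁)) ,
  (λ r o₁ d₁ → OD r (O₁⊆O V r o₁) (D₁⊆D V r d₁)) ,
  (λ r l₁ d₁ → ⊎.[ (λ l → LD r l (D₁⊆D V r d₁)) , (λ o₂ → OD r (O₂⊆O V r o₂) (D₁⊆D V r d₁)) ]
                  (L₁⊆L∪O₂ V r l₁))

record Split (ρ ρ₁ ρ₂ : RConf) : Set where
  field
    wf    : IsRConf ρ
    view₁ : View (O ρ₂) ρ ρ₁
    view₂ : View (O ρ₁) ρ ρ₂
open Split public

Split-swap : ∀ {ρ ρ₁ ρ₂} → Split ρ ρ₁ ρ₂ → Split ρ ρ₂ ρ₁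
Split-swap S = record { wf = wf S ; view₁ = view₂ S ; view₂ = view₁ S }

env-conserves : ∀ {O₂ ρ ρ₁ L' D'} → View O₂ ρ ρ₁ → (L' ∪ᵣ D') ≃ᵣ (L ρ ∪ᵣ D ρ) →
  ((L' ∪ᵣ O₂) ∪ᵣ D') ≃ᵣ (L ρ₁ ∪ᵣ D ρ₁)
env-conserves {O₂} {ρ} {ρ₁} {L'} {D'} V LD' x = mk⇔ to′ from′
  where
  into-view : (L ρ ∪ᵣ D ρ) x → (L ρ₁ ∪ᵣ D ρ₁) x
  into-view = ⊎.map (L⊆L₁ V x) (D⊆D₁ V x)
  to′ : ((L' ∪ᵣ O₂) ∪ᵣ D') x → (L ρ₁ ∪ᵣ D ρ₁) x
  to′ (inj₁ (inj₁ l)) = into-view (to (LD' x) (inj₁ l))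
  to′ (inj₁ (inj₂ o)) = inj₁ (O₂⊆L₁ V x o)
  to′ (inj₂ d)        = into-view (to (LD' x) (inj₂ d))
  from′ : (L ρ₁ ∪ᵣ D ρ₁) x → ((L' ∪ᵣ O₂) ∪ᵣ D') x
  from′ (inj₁ l₁) = ⊎.[ ⊎.map₁ inj₁ ∘ from (LD' x) ∘ inj₁ , inj₁ ∘ inj₂ ] (L₁⊆L∪O₂ V x l₁)
  from′ (inj₂ d₁) = ⊎.map₁ inj₁ (from (LD' x) (inj₂ (D₁⊆D V x d₁)))

-- What thread b does not own is conserved by a step of its sibling a.
sibling-conserves : ∀ {ρ ρ' ρa ρa' ρb} → View (O ρb) ρ ρa → View (O ρa) ρ ρb → View (O ρb) ρ' ρa' →
  L ρ' ≃ᵣ L ρ → (O ρa' ∪ᵣ D ρa') ≃ᵣ (O ρa ∪ᵣ D ρa) →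
  ((L ρ' ∪ᵣ O ρa') ∪ᵣ D ρ') ≃ᵣ (L ρb ∪ᵣ D ρb)
sibling-conserves {ρ} {ρ'} {ρa} {ρa'} {ρb} Va Vb Va' L'≃L OD'≃OD x = mk⇔ to′ from′
  where
  from-a : (O ρa ∪ᵣ D ρa) x → (L ρb ∪ᵣ D ρb) x
  from-a = ⊎.map (O₂⊆L₁ Vb x) (D⊆D₁ Vb x ∘ D₁⊆D Va x)
  to′ : ((L ρ' ∪ᵣ O ρa') ∪ᵣ D ρ') x → (L ρb ∪ᵣ D ρb) x
  to′ (inj₁ (inj₁ l)) = inj₁ (L⊆L₁ Vb x (to (L'≃L x) l))
  to′ (inj₁ (inj₂ o)) = from-a (to (OD'≃OD x) (inj₁ o))
  to′ (inj₂ d)        = from-a (to (OD'≃OD x) (inj₂ (D⊆D₁ Va' x d)))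
  into-a' : (O ρa ∪ᵣ D ρa) x → ((L ρ' ∪ᵣ O ρa') ∪ᵣ D ρ') x
  into-a' = ⊎.[ inj₁ ∘ inj₂ , inj₂ ∘ D₁⊆D Va' x ] ∘ from (OD'≃OD x)
  from′ : (L ρb ∪ᵣ D ρb) x → ((L ρ' ∪ᵣ O ρa') ∪ᵣ D ρ') x
  from′ (inj₁ lb) = ⊎.[ inj₁ ∘ inj₁ ∘ from (L'≃L x) , into-a' ∘ inj₁ ] (L₁⊆L∪O₂ Vb x lb)
  from′ (inj₂ db) = into-a' (inj₂ (D⊆D₁ Va x (D₁⊆D Vb x db)))

safe-skip⇒sat : ∀ {n s h ρ Γ Q A} → Safe (suc n) skip s h ρ Γ Q A → (s , h) ⊨ Q
safe-skip⇒sat safe = proj₁ safe refl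

safe⇒¬abort : ∀ {n C s h ρ Γ Q A} → Safe (suc n) C s h ρ Γ Q A → ¬ (C , s , h , ρ ⟶abort)
safe⇒¬abort = proj₁ ∘ proj₂

safe⇒race-free : ∀ {n C s h ρ Γ Q A} → Safe (suc n) C s h ρ Γ Q A →
  Disjointᵥ (chng C) (PVs Γ (L ρ ∪ᵣ D ρ))
safe⇒race-free = proj₁ ∘ proj₂ ∘ proj₂

race-free-unview : ∀ {O₂ ρ ρ₁ Γ C} → View O₂ ρ ρ₁ → Disjointᵥ (chng C) (PVs Γ (L ρ₁ ∪ᵣ D ρ₁)) →
  Disjointᵥ (chng C) (PVs Γ (L ρ ∪ᵣ D ρ))
race-free-unview V race-free x c (r , lock , pv) =
  race-free x c (r , ⊎.map (L⊆L₁ V r) (D⊆D₁ V r) lock , pv)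

module _ {Γ : ResCtx} (wfΓ : WFResCtx Γ) where

  -- Clause (iv) of Safe, with Safe n C' generalised to any property P of the local heap.
  Resplit : Store → Heap → RConf → (Heap → Set₁) → Set₁
  Resplit s' ĥ ρ' P =
    Σ Heap λ h' → Σ Heap λ hG' → h' ⊥ₕ hG' × ĥ ≈ₕ (h' ∪ₕ hG') × ⊛sat s' hG' Γ (D ρ') × P h'

  Resplit-map : ∀ {s'} ĥ ρ' {P P' : Heap → Set₁} → (∀ {h} → P h → P' h) →
    Resplit s' ĥ ρ' P → Resplit s' ĥ ρ' P'
  Resplit-map _ _ f (h' , hG' , d , split , sat , p) = h' , hG' , d , split , sat , f p

  skip-safe : ∀ n {s h ρ Q A} → (s , h) ⊨ Q → FV Q ⊆ᵥ A → Safe n skip s h ρ Γ Q A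
  skip-safe zero    q fv = lift _
  skip-safe (suc n) {s} {h} {Q = Q} {A} q fv = (λ _ → q) , (λ ()) , (λ _ ()) , λ where
      hG d sat _ _ _ _ (prog ())
      hG d sat _ _ _ _ (envt e) → skip-env e ≈-refl (mk# d) sat
    where
    skip-env : ∀ {X ρ s' X' ρ' hG} → EnvStep A Γ skip s X ρ s' X' ρ' → X ≈ h ∪ₕ hG → h # hG →
      ⊛sat s hG Γ (D ρ) → Resplit s' X' ρ' λ h' → Safe n skip s' h' ρ' Γ Q A
    skip-env (env d d' ag _ _ sat sat') X≈ d₀ sat₀ =
      _ , _ , d' , (λ _ → refl) , sat' ,
      skip-safe n (⊨-cong Q (λ x → ag x ∘ inj₁ ∘ fv x) (⊛sat-cancel Γ wfΓ (≈-sym X≈) d₀ (mk# d) sat₀ sat) q)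
        fv

  -- h ≈ h' by precision of the invariants.
  env-safe : ∀ {n C s h ρ Q A hG hG' s' L' D'} → Safe (suc n) C s h ρ Γ Q A →
    h # hG → h # hG' → AgreeOn (A ∪ᵥ PVs Γ (Locked C)) s s' → (L' ∪ᵣ D') ≃ᵣ (L ρ ∪ᵣ D ρ) →
    IsRConf ⟨ O ρ , L' , D' ⟩ → ⊛sat s hG Γ (D ρ) → ⊛sat s' hG' Γ D' →
    Σ Heap λ h' → h ≈ h' × Safe n C s' h' ⟨ O ρ , L' , D' ⟩ Γ Q A
  env-safe (_ , _ , _ , steps) (mk# d) (mk# d') ag LD' wf' sat sat' =
    let h' , _ , d'' , split , sat'' , safe =
          steps _ d sat _ _ _ _ (envt (env d d' ag LD' wf' sat sat'))
    in h' , ⊛sat-cancel Γ wfΓ (mk≈ split) (mk# d') (mk# d'') sat' sat'' , safe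

  -- A thread that does not fault holds every resource it is inside, which its
  -- sibling therefore sees as locked, so the sibling cannot write the protected variables.
  sibling-agrees : ∀ {Ca Cb s s' Y Y' ρ ρa ρa' Ca' hb ρb Ab} →
    ¬ (Cb , s , hb , ρb ⟶abort) → View (O ρb) ρ ρa → Disjointᵥ Ab (mod Ca) →
    Disjointᵥ (chng Ca) (PVs Γ (L ρa ∪ᵣ D ρa)) → Ca , s , Y , ρa ⟶ₚ Ca' , s' , Y' , ρa' →
    AgreeOn (Ab ∪ᵥ PVs Γ (Locked Cb)) s s'
  sibling-agrees {Ca} {Cb} safe-b Va Ab#mod race-free st x (inj₁ a) =
    step-preserves-var st x λ c → Ab#mod x a (chng⊆mod Ca x c)
  sibling-agrees {Ca} {Cb} safe-b Va Ab#mod race-free st x (inj₂ (r , lk , pv)) =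
    step-preserves-var st x λ c →
      locked-owned Cb safe-b lk λ o → race-free x c (r , inj₁ (O₂⊆L₁ Va r o) , pv)

  record ParSafe (n : ℕ) (C₁ C₂ : Cmd) (s : Store) (H : Heap) (ρ : RConf)
                 (Q₁ Q₂ : Assn) (A₁ A₂ : VarSet) : Set₁ where
    field
      h₁ h₂      : Heap
      ρ₁ ρ₂      : RConf
      heaps      : h₁ # h₂
      heap-split : H ≈ h₁ ∪ₕ h₂
      conf-split : Split ρ ρ₁ ρ₂
      A₁#mod₂    : Disjointᵥ A₁ (mod C₂)
      A₂#mod₁    : Disjointᵥ A₂ (mod C₁)
      safe₁      : Safe n C₁ s h₁ ρ₁ Γ Q₁ A₁
      safe₂      : Safe n C₂ s h₂ ρ₂ Γ Q₂ A₂

  ParSafe-swap : ∀ {n C₁ C₂ s H ρ Q₁ Q₂ A₁ A₂} →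
    ParSafe n C₁ C₂ s H ρ Q₁ Q₂ A₁ A₂ → ParSafe n C₂ C₁ s H ρ Q₂ Q₁ A₂ A₁
  ParSafe-swap ps = record
    { h₁ = h₂ ; h₂ = h₁ ; ρ₁ = ρ₂ ; ρ₂ = ρ₁
    ; heaps = #-sym heaps ; heap-split = ≈-trans heap-split (∪-comm heaps)
    ; conf-split = Split-swap conf-split
    ; A₁#mod₂ = A₂#mod₁ ; A₂#mod₁ = A₁#mod₂ ; safe₁ = safe₂ ; safe₂ = safe₁ }
    where open ParSafe ps

  -- For the sibling b the step is an environment step into the sibling view of
  -- a's new configuration.
  left-step : ∀ {n Ca Cb Qa Qb Aa Ab s H ρ hG Ca' s' X' ρ'} →
    ParSafe (suc n) Ca Cb s H ρ Qa Qb Aa Ab → H # hG → ⊛sat s hG Γ (D ρ) →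
    Ca , s , H ∪ₕ hG , ρ ⟶ₚ Ca' , s' , X' , ρ' →
    Resplit s' X' ρ' λ h' → ParSafe n Ca' Cb s' h' ρ' Qa Qb Aa Ab
  left-step {hG = hG} ps H#hG sat st =
    let Va = view₁ conf-split
        Vb = view₂ conf-split
        ha#hG = #-monoˡ (partˡ heap-split) H#hG
        hb#hG = #-monoˡ (partʳ heaps heap-split) H#hG
        _ , no-abort , race-free , steps = safe₁
        Y' , ρa' , sta , X'≈ , Y'#hb , Va' =
          step-frame st Va (view-IsRConf Va (wf conf-split))
            (≈-trans (∪-congˡ hG heap-split) (∪-swapʳ h₁ hb#hG)) (∪-# heaps (#-sym hb#hG)) ⊑-∪ˡ no-abort
        ha' , hGa , ha'⊥hGa , Y'≈ₕ , satGa , safeA =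
          steps hG (un# ha#hG) (⊛sat-resp Γ (D⊆D₁ Va) (D₁⊆D Va) sat) _ _ _ _ (prog sta)
        ha'#hGa : ha' # hGa
        ha'#hGa = mk# ha'⊥hGa
        Y'≈ : Y' ≈ ha' ∪ₕ hGa
        Y'≈ = mk≈ Y'≈ₕ
        hb' , hb≈hb' , safeB =
          env-safe safe₂ hb#hG (#-sym (#-monoˡ (partʳ ha'#hGa Y'≈) Y'#hb))
            (sibling-agrees (safe⇒¬abort safe₂) Va A₂#mod₁ race-free sta)
            (sibling-conserves Va Vb Va' (step-preserves-L st) (step-preserves-O∪D sta))
            (view-IsRConf (sibling-view Va') (step-preserves-IsRConf st (wf conf-split)))
            (⊛sat-resp Γ (D⊆D₁ Vb) (D₁⊆D Vb) sat) (⊛sat-resp Γ (D₁⊆D Va') (D⊆D₁ Va') satGa)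
        ha'#hb' , ∪#hGa , X'≈' = reassemble X'≈ Y'≈ ha'#hGa Y'#hb hb≈hb'
    in ha' ∪ₕ hb' , hGa , un# ∪#hGa , un≈ X'≈' , ⊛sat-resp Γ (D₁⊆D Va') (D⊆D₁ Va') satGa , record
         { h₁ = ha' ; h₂ = hb' ; ρ₁ = ρa' ; ρ₂ = _
         ; heaps = ha'#hb' ; heap-split = ≈-refl
         ; conf-split = record
             { wf = step-preserves-IsRConf st (wf conf-split) ; view₁ = Va' ; view₂ = sibling-view Va' }
         ; A₁#mod₂ = A₁#mod₂ ; A₂#mod₁ = λ x a → A₂#mod₁ x a ∘ step-mod-mono st x
         ; safe₁ = safeA ; safe₂ = safeB }
    where open ParSafe ps

  -- X is kept apart from H ∪ₕ hG so that env, whose heap index is a union, can be matched.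
  env-step : ∀ {n C₁ C₂ Q₁ Q₂ A₁ A₂ s H ρ hG X s' X' ρ'} →
    ParSafe (suc n) C₁ C₂ s H ρ Q₁ Q₂ A₁ A₂ → X ≈ H ∪ₕ hG → H # hG → ⊛sat s hG Γ (D ρ) →
    EnvStep (A₁ ∪ᵥ A₂) Γ (C₁ ∥ C₂) s X ρ s' X' ρ' →
    Resplit s' X' ρ' λ h' → ParSafe n C₁ C₂ s' h' ρ' Q₁ Q₂ A₁ A₂
  env-step {n} {C₁} {C₂} {A₁ = A₁} {A₂} {s} {H} {ρ} {hG} {s' = s'} ps X≈ H#hG sat
           (env {h = H'} {L' = L'} {D' = D'} d d' ag LD' wf' sat₀ sat') =
    let h₁' , h₁≈ , safe₁' = thread (partˡ heap-split) (view₁ conf-split) safe₁ agree₁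
        h₂' , h₂≈ , safe₂' = thread (partʳ heaps heap-split) (view₂ conf-split) safe₂ agree₂
    in H' , _ , d' , (λ _ → refl) , sat' , record
         { h₁ = h₁' ; h₂ = h₂' ; ρ₁ = _ ; ρ₂ = _
         ; heaps = #-cong h₁≈ h₂≈ heaps
         ; heap-split = ≈-trans (≈-sym H≈H') (≈-trans heap-split (∪-cong h₁≈ h₂≈))
         ; conf-split = record
             { wf = wf' ; view₁ = env-view (view₁ conf-split) ; view₂ = env-view (view₂ conf-split) }
         ; A₁#mod₂ = A₁#mod₂ ; A₂#mod₁ = A₂#mod₁ ; safe₁ = safe₁' ; safe₂ = safe₂' }
    where
    open ParSafe ps
    H≈H' : H ≈ H'
    H≈H' = ⊛sat-cancel Γ wfΓ (≈-sym X≈) H#hG (mk# d) sat sat₀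
    thread : ∀ {C h ρᵢ O₂ Q A} → h ⊑ H → View O₂ ρ ρᵢ → Safe (suc n) C s h ρᵢ Γ Q A →
      AgreeOn (A ∪ᵥ PVs Γ (Locked C)) s s' →
      Σ Heap λ h' → h ≈ h' × Safe n C s' h' ⟨ O ρᵢ , L' ∪ᵣ O₂ , D' ⟩ Γ Q A
    thread ⊑H V safe agᵢ =
      env-safe safe (#-monoˡ ⊑H H#hG) (#-monoˡ (⊑-trans ⊑H (≈⇒⊑ H≈H')) (mk# d')) agᵢ
        (env-conserves V LD') (view-IsRConf (env-view V) wf') (⊛sat-resp Γ (D⊆D₁ V) (D₁⊆D V) sat) sat'
    agree₁ : AgreeOn (A₁ ∪ᵥ PVs Γ (Locked C₁)) s s'
    agree₁ x = ⊎.[ ag x ∘ inj₁ ∘ inj₁ , (λ { (r , lk , pv) → ag x (inj₂ (r , inj₁ lk , pv)) }) ]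
    agree₂ : AgreeOn (A₂ ∪ᵥ PVs Γ (Locked C₂)) s s'
    agree₂ x = ⊎.[ ag x ∘ inj₁ ∘ inj₂ , (λ { (r , lk , pv) → ag x (inj₂ (r , inj₂ lk , pv)) }) ]

  par-safe : ∀ n {C₁ C₂ s H ρ Q₁ Q₂ A₁ A₂} → FV Q₁ ⊆ᵥ A₁ → FV Q₂ ⊆ᵥ A₂ →
    ParSafe n C₁ C₂ s H ρ Q₁ Q₂ A₁ A₂ → Safe n (C₁ ∥ C₂) s H ρ Γ (Q₁ `∗ Q₂) (A₁ ∪ᵥ A₂)
  par-safe zero    fv₁ fv₂ ps = lift _
  par-safe (suc n) {C₁} {C₂} {H = H} fv₁ fv₂ ps = (λ ()) , no-abort , race-free , λ where
      hG d sat _ _ ĥ ρ' (prog (P1 st)) →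
        Resplit-map ĥ ρ' (par-safe n fv₁ fv₂) (left-step ps (mk# {H} d) sat st)
      hG d sat _ _ ĥ ρ' (prog (P2 st)) →
        Resplit-map ĥ ρ' (par-safe n fv₁ fv₂ ∘ ParSafe-swap)
          (left-step (ParSafe-swap ps) (mk# {H} d) sat st)
      hG d sat _ _ _ _ (prog P3) →
        H , hG , d , (λ _ → refl) , sat ,
        skip-safe n (h₁ , h₂ , un# heaps , un≈ heap-split , safe-skip⇒sat safe₁ , safe-skip⇒sat safe₂)
          (λ x → ⊎.map (fv₁ x) (fv₂ x))
      hG d sat _ _ ĥ ρ' (envt e) →
        Resplit-map ĥ ρ' (par-safe n fv₁ fv₂) (env-step ps ≈-refl (mk# {H} d) sat e)
    where
    open ParSafe ps
    no-abort : ¬ ((C₁ ∥ C₂) , _ , _ , _ ⟶abort)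
    no-abort (PA1 a) = safe⇒¬abort safe₁ (abort-restrict a (view₁ conf-split) (partˡ heap-split))
    no-abort (PA2 a) = safe⇒¬abort safe₂ (abort-restrict a (view₂ conf-split) (partʳ heaps heap-split))
    race-free : Disjointᵥ (chng (C₁ ∥ C₂)) (PVs Γ _)
    race-free x (inj₁ c) = race-free-unview {C = C₁} (view₁ conf-split) (safe⇒race-free safe₁) x c
    race-free x (inj₂ c) = race-free-unview {C = C₂} (view₂ conf-split) (safe⇒race-free safe₂) x c

proposition13 : (n : ℕ) (C₁ C₂ : Cmd) (Q₁ Q₂ : Assn) (s : Store) (h₁ h₂ : Heap)
    (Γ : ResCtx) (A₁ A₂ : VarSet) (O₁ O₂ L D : RSet) →
    WFResCtx Γ →
    Reachable (C₁ ∥ C₂) →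
    h₁ ⊥ₕ h₂ →
    IsRConf ⟨ O₁ ∪ᵣ O₂ , L , D ⟩ →
    IsRConf ⟨ O₁ , L ∪ᵣ O₂ , D ⟩ →
    IsRConf ⟨ O₂ , L ∪ᵣ O₁ , D ⟩ →
    FV Q₁ ⊆ᵥ A₁ → FV Q₂ ⊆ᵥ A₂ →
    Disjointᵥ A₁ (mod C₂) → Disjointᵥ A₂ (mod C₁) →
    Safe n C₁ s h₁ ⟨ O₁ , L ∪ᵣ O₂ , D ⟩ Γ Q₁ A₁ →
    Safe n C₂ s h₂ ⟨ O₂ , L ∪ᵣ O₁ , D ⟩ Γ Q₂ A₂ →
    Safe n (C₁ ∥ C₂) s (h₁ ∪ₕ h₂) ⟨ O₁ ∪ᵣ O₂ , L , D ⟩ Γ (Q₁ `∗ Q₂) (A₁ ∪ᵥ A₂)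
proposition13 n C₁ C₂ Q₁ Q₂ s h₁ h₂ Γ A₁ A₂ O₁ O₂ L D wfΓ _ h₁⊥h₂ wf wf₁ _ fv₁ fv₂ A₁#mod₂ A₂#mod₁
              safe₁ safe₂ =
  par-safe wfΓ n fv₁ fv₂ record
    { h₁ = h₁ ; h₂ = h₂ ; ρ₁ = _ ; ρ₂ = _
    ; heaps = mk# h₁⊥h₂ ; heap-split = ≈-refl
    ; conf-split = record { wf = wf ; view₁ = view ; view₂ = sibling-view view }
    ; A₁#mod₂ = A₁#mod₂ ; A₂#mod₁ = A₂#mod₁ ; safe₁ = safe₁ ; safe₂ = safe₂ }
  where
  view : View O₂ ⟨ O₁ ∪ᵣ O₂ , L , D ⟩ ⟨ O₁ , L ∪ᵣ O₂ , D ⟩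
  view = thread-view (λ _ o → o) (λ _ → inj₁) (λ _ → inj₂) (λ r o₁ o₂ → proj₁ wf₁ r o₁ (inj₂ o₂))
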